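{- Let $\tau, \eta \in P_n$ with $\tau \leq \eta$, and let $i \in \mathbb{Z}/2n\mathbb{Z}$. If $i \in A(\tau)$ and $i \in B(\eta)$, then $\tau \leq s_i \cdot \eta$ and $s_i \cdot \tau \leq \eta$.
   Context: Let $P_n$ be the set of perfect matchings of $2n$ points labeled $1,\ldots,2n$ in order around a circle (labels read modulo $2n$, so $2n+1 = 1$). Matchings are represented by lensless medial graphs (strand diagrams in the disk, each pair of the matching joined by a strand, any two strands crossing at most once); $c(\tau)$ is the number of crossings. The partial order on $P_n$ is generated by the covers $\tau' \lessdot \tau$ whenever resolving one crossing (replacing it by one of its two non-crossing smoothings) in some lensless medial graph of $\tau$ yields a lensless medial graph of $\tau'$. For $\tau \in P_n$ and $i \in \mathbb{Z}/2n\mathbb{Z}$: $i \in A(\tau)$ if the strands with endpoints $i$ and $i+1$ are different and do not cross; $i \in B(\tau)$ if they are different and cross; $i \in C(\tau)$ if $i$ is matched with $i+1$. Thus $\mathbb{Z}/2n\mathbb{Z} = A(\tau) \sqcup B(\tau) \sqcup C(\tau)$. The matching $s_i \cdot \tau$ is obtained from $\tau$ by interchanging the labels $i$ and $i+1$ (if $\tau$ pairs $i$ with $a$ and $i+1$ with $b$, then $s_i\cdot\tau$ pairs $i$ with $b$ and $i+1$ with $a$, other pairs unchanged). Then $s_i\cdot\tau \gtrdot \tau$ if $i \in A(\tau)$, $s_i \cdot \tau \lessdot \tau$ if $i \in B(\tau)$, and $s_i \cdot \tau = \tau$ if $i \in C(\tau)$. -}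

module Defs where

open import Data.Nat as ℕ using (ℕ; zero; suc; _*_; _<ᵇ_; _⊔_; _⊓_)
open import Data.Fin as Fin using (Fin; toℕ; lower₁; _≟_)
open import Data.Bool using (Bool; true; false; _∧_; _xor_; if_then_else_)
open import Data.Vec using (Vec; lookup; tabulate)
open import Data.List using (List; map; allFin)
open import Data.Nat.ListAction using (sum)
open import Data.Product using (Σ; ∃; ∃-syntax; _×_; _,_)
open import Relation.Nullary using (¬_; does)
open import Relation.Binary.PropositionalEquality using (_≡_; _≢_)
open import Relation.Binary.Construct.Closure.ReflexiveTransitive using (Star)

-- A (candidate) matching on the points of Fin m (m = 2n), points 0..m-1
-- in circular order; τ sends each point to its partner.
Mat : ℕ → Set
Mat m = Vec (Fin m) m

IsPerfectMatching : ∀ {m} → Mat m → Set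
IsPerfectMatching {m} τ = (j : Fin m) → (lookup τ (lookup τ j) ≡ j) × (lookup τ j ≢ j)

P : ℕ → Set
P n = Σ (Mat (2 * n)) IsPerfectMatching

next : ∀ {m} → Fin m → Fin m
next {suc k} i with k ℕ.≟ toℕ i
... | Relation.Nullary.yes _ = Fin.zero
... | Relation.Nullary.no ne = Fin.suc (lower₁ i ne)

swapAt : ∀ {m} → Fin m → Fin m → Fin m
swapAt i j = if does (j ≟ i) then next i else (if does (j ≟ next i) then i else j)

act : ∀ {m} → Fin m → Mat m → Mat m
act i τ = tabulate (λ j → swapAt i (lookup τ (swapAt i j)))

between : ℕ → ℕ → ℕ → Bool
between lo x hi = (lo <ᵇ x) ∧ (x <ᵇ hi)

crosses : ∀ {m} → Fin m → Fin m → Fin m → Fin m → Bool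
crosses a a' b b' =
  let lo = toℕ a ⊓ toℕ a' ; hi = toℕ a ⊔ toℕ a'
  in between lo (toℕ b) hi xor between lo (toℕ b') hi

crossingNumber : ∀ {m} → Mat m → ℕ
crossingNumber {m} τ =
  sum (map (λ a → sum (map (λ b →
         if (toℕ a <ᵇ toℕ (lookup τ a)) ∧ (toℕ b <ᵇ toℕ (lookup τ b)) ∧ (toℕ a <ᵇ toℕ b)
               ∧ crosses a (lookup τ a) b (lookup τ b)
         then 1 else 0) (allFin m))) (allFin m))

-- replace the chords {a,τa},{b,τb} by {a,b},{τa,τb}
rewire : ∀ {m} → Mat m → Fin m → Fin m → Mat m
rewire τ a b = tabulate λ j →
  if does (j ≟ a) then b else
  if does (j ≟ b) then a else
  if does (j ≟ lookup τ a) then lookup τ b else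
  if does (j ≟ lookup τ b) then lookup τ a else lookup τ j

-- τ' ⋖ τ : τ' is obtained by resolving a crossing (of the crossing chords
-- {a,τa},{b,τb}; the two smoothings correspond to the choices b or τb)
-- and the result is lensless, i.e. c(τ') = c(τ) - 1.
_⋖_ : ∀ {m} → Mat m → Mat m → Set
_⋖_ {m} τ' τ = ∃[ a ] ∃[ b ]
  (crosses a (lookup τ a) b (lookup τ b) ≡ true)
  × (τ' ≡ rewire τ a b)
  × (suc (crossingNumber τ') ≡ crossingNumber τ)

_≤M_ : ∀ {m} → Mat m → Mat m → Set
τ ≤M η = Star _⋖_ τ η

InA : ∀ {m} → Mat m → Fin m → Set
InA τ i = (lookup τ i ≢ next i) × (crosses i (lookup τ i) (next i) (lookup τ (next i)) ≡ false)

InB : ∀ {m} → Mat m → Fin m → Set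
InB τ i = (lookup τ i ≢ next i) × (crosses i (lookup τ i) (next i) (lookup τ (next i)) ≡ true)

{-# OPTIONS --safe #-}
-- Write u(τ) and l(τ) for the larger and the smaller of τ and s_i · τ (both are τ when i is matched
-- with i + 1). As i ∈ A(τ) and i ∈ B(η), u(τ) = s_i · τ, u(η) = η, l(τ) = τ and l(η) = s_i · η, so
-- it suffices that u and l are monotone along every cover σ ⋖ τ. If the crossing resolved in τ is
-- not the one between the strands at i and i + 1, conjugating by s_i turns σ ⋖ τ into
-- s_i · σ ⋖ s_i · τ; if it is, its two smoothings are s_i · τ and a matching pairing i with i + 1.
-- The remaining cases are excluded by counting crossings: s_i changes the crossing number by ±1,
-- and resolving a crossing never increases it.
module Submission where

open import Defs
open import Data.Nat as ℕ using (ℕ; zero; suc; _+_; _*_; _<ᵇ_; _⊔_; _⊓_; _<_; _≤_; z≤n; s≤s)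
open import Data.Nat.Properties hiding (_≟_)
open import Data.Fin as Fin using (Fin; toℕ; _≟_)
open import Data.Fin.Properties using (toℕ-injective; toℕ-lower₁; toℕ<n)
open import Data.Fin.Permutation using (permutation)
open import Data.Vec using (lookup)
open import Data.Vec.Properties using (lookup∘tabulate; tabulate∘lookup; tabulate-cong)
open import Data.List using (map; allFin)
import Data.List as List
import Data.List.Properties as ListP
import Data.Nat.ListAction as ListAction
open import Data.Bool as Bool using (Bool; true; false; _∧_; _∨_; _xor_; not; if_then_else_)
open import Data.Bool.Properties using (∧-comm; ∨-comm; ∧-zeroʳ; ∨-zeroʳ; xor-comm; xor-identityʳ; true-xor; not-involutive; T-≡)
open import Data.Nat.Solver using (module +-*-Solver)
open import Data.Unit using (tt)
open import Function.Bundles using (Equivalence)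
open import Data.Product using (_×_; _,_; proj₁; proj₂)
open import Data.Sum using (_⊎_; inj₁; inj₂)
open import Data.Empty using (⊥-elim)
open import Relation.Nullary using (¬_; yes; no; does; Dec)
open import Relation.Nullary.Decidable using (True; toWitness)
open import Relation.Binary using (tri<; tri≈; tri>)
open import Relation.Binary.PropositionalEquality
open import Relation.Binary.Construct.Closure.ReflexiveTransitive using (ε; _◅_; _◅◅_)
open import Algebra.Properties.Semiring.Sum +-*-semiring
  using (∑-distrib-+; ∑-comm; sum-permute; sum-cong-≗; *-distribˡ-sum; *-distribʳ-sum) renaming (sum to ∑)

true≢false : true ≢ false
true≢false ()

BoolFun : ℕ → Set
BoolFun zero    = Bool
BoolFun (suc n) = Bool → BoolFun n

_≗ᵇ_ : ∀ {n} → BoolFun n → BoolFun n → Set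
_≗ᵇ_ {zero}  f g = f ≡ g
_≗ᵇ_ {suc n} f g = ∀ x → f x ≗ᵇ g x

_≗ᵇ?_ : ∀ {n} (f g : BoolFun n) → Dec (f ≗ᵇ g)
_≗ᵇ?_ {zero}  f g = f Bool.≟ g
_≗ᵇ?_ {suc n} f g with f true ≗ᵇ? g true | f false ≗ᵇ? g false
... | yes t | yes e = yes λ { true → t ; false → e }
... | no ¬t | _     = no λ h → ¬t (h true)
... | yes _ | no ¬e = no λ h → ¬e (h false)

truth-table : ∀ n (f g : BoolFun n) → {True (f ≗ᵇ? g)} → f ≗ᵇ g
truth-table n f g {ok} = toWitness ok

∧-true⇒ : ∀ {x y} → x ∧ y ≡ true → x ≡ true × y ≡ true
∧-true⇒ {true} {true} _ = refl , refl

xor-trueʳ : ∀ x → x xor true ≡ not x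
xor-trueʳ x = trans (xor-comm x true) (true-xor x)

xor-true⇒ : ∀ {x y} → x xor y ≡ true → x ≡ true ⊎ y ≡ true
xor-true⇒ {true}  _ = inj₁ refl
xor-true⇒ {false} p = inj₂ p

xor-exclusive : ∀ x y → x ∧ y ≡ false → x xor y ≡ x ∨ y
xor-exclusive true  true  ()
xor-exclusive true  false _ = refl
xor-exclusive false y     _ = refl

𝟙 : Bool → ℕ
𝟙 b = if b then 1 else 0

𝟙≤1 : ∀ b → 𝟙 b ≤ 1
𝟙≤1 true  = ≤-refl
𝟙≤1 false = z≤n

𝟙-∧ : ∀ x y → 𝟙 (x ∧ y) ≡ 𝟙 x * 𝟙 y
𝟙-∧ true  y = sym (+-identityʳ (𝟙 y))
𝟙-∧ false y = refl

𝟙-xor-exclusive : ∀ x y → x ∧ y ≡ false → 𝟙 (x xor y) ≡ 𝟙 x + 𝟙 y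
𝟙-xor-exclusive true  true  ()
𝟙-xor-exclusive true  false _ = refl
𝟙-xor-exclusive false y     _ = refl

𝟙-xor₃ : ∀ c p q → (p ≡ true → c ≡ false) → (q ≡ true → c ≡ false) → p ∧ q ≡ false →
  𝟙 (c xor (p xor q)) ≡ 𝟙 c + (𝟙 p + 𝟙 q)
𝟙-xor₃ c true  true  _   _   ()
𝟙-xor₃ c true  false p⇒¬c _  _ rewrite p⇒¬c refl = refl
𝟙-xor₃ c false true  _   q⇒¬c _ rewrite q⇒¬c refl = refl
𝟙-xor₃ c false false _   _   _ = trans (cong 𝟙 (xor-identityʳ c)) (sym (+-identityʳ (𝟙 c)))

𝟙-split : ∀ x y l c → 𝟙 (x ∧ y ∧ c) ≡ 𝟙 (x ∧ y ∧ l ∧ c) + 𝟙 (y ∧ x ∧ not l ∧ c)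
𝟙-split true  true  true  c = sym (+-identityʳ (𝟙 c))
𝟙-split true  true  false c = refl
𝟙-split true  false l     c = refl
𝟙-split false true  l     c = refl
𝟙-split false false l     c = refl

resolve-≤ : ∀ x y z w → ¬ (x ≡ y × z ≡ w × x ≡ not z) →
  𝟙 (x xor z) + (𝟙 (y xor w) + (𝟙 (z xor x) + 𝟙 (w xor y))) ≤ 𝟙 (x xor y) + (𝟙 (y xor x) + (𝟙 (z xor w) + 𝟙 (w xor z)))
resolve-≤ true  true  true  true  _ = ≤ᵇ⇒≤ _ _ tt
resolve-≤ true  true  true  false _ = ≤ᵇ⇒≤ _ _ tt
resolve-≤ true  true  false true  _ = ≤ᵇ⇒≤ _ _ tt
resolve-≤ true  true  false false h = ⊥-elim (h (refl , refl , refl))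
resolve-≤ true  false true  true  _ = ≤ᵇ⇒≤ _ _ tt
resolve-≤ true  false true  false _ = ≤ᵇ⇒≤ _ _ tt
resolve-≤ true  false false true  _ = ≤ᵇ⇒≤ _ _ tt
resolve-≤ true  false false false _ = ≤ᵇ⇒≤ _ _ tt
resolve-≤ false true  true  true  _ = ≤ᵇ⇒≤ _ _ tt
resolve-≤ false true  true  false _ = ≤ᵇ⇒≤ _ _ tt
resolve-≤ false true  false true  _ = ≤ᵇ⇒≤ _ _ tt
resolve-≤ false true  false false _ = ≤ᵇ⇒≤ _ _ tt
resolve-≤ false false true  true  h = ⊥-elim (h (refl , refl , refl))
resolve-≤ false false true  false _ = ≤ᵇ⇒≤ _ _ tt
resolve-≤ false false false true  _ = ≤ᵇ⇒≤ _ _ tt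
resolve-≤ false false false false _ = ≤ᵇ⇒≤ _ _ tt

<ᵇ-true : ∀ {m n} → m < n → (m <ᵇ n) ≡ true
<ᵇ-true m<n = Equivalence.to T-≡ (<⇒<ᵇ m<n)

<ᵇ-true⇒< : ∀ {m n} → (m <ᵇ n) ≡ true → m < n
<ᵇ-true⇒< {m} {n} eq = <ᵇ⇒< m n (Equivalence.from T-≡ eq)

<ᵇ-false : ∀ {m n} → n ≤ m → (m <ᵇ n) ≡ false
<ᵇ-false {m} {n} n≤m with m <ᵇ n in eq
... | false = refl
... | true  = ⊥-elim (<⇒≱ (<ᵇ-true⇒< eq) n≤m)

<ᵇ-false⇒≥ : ∀ {m n} → (m <ᵇ n) ≡ false → n ≤ m
<ᵇ-false⇒≥ {m} {n} eq = ≮⇒≥ λ m<n → true≢false (trans (sym (<ᵇ-true m<n)) eq)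

<ᵇ-irrefl : ∀ m → (m <ᵇ m) ≡ false
<ᵇ-irrefl m = <ᵇ-false {m} ≤-refl

<ᵇ-asym : ∀ {m n} → m ≢ n → (n <ᵇ m) ≡ not (m <ᵇ n)
<ᵇ-asym {m} {n} m≢n with <-cmp m n
... | tri< m<n _ _ rewrite <ᵇ-true m<n | <ᵇ-false {n} {m} (<⇒≤ m<n) = refl
... | tri≈ _ m≡n _ = ⊥-elim (m≢n m≡n)
... | tri> _ _ n<m rewrite <ᵇ-true n<m | <ᵇ-false {m} {n} (<⇒≤ n<m) = refl

suc-<ᵇ-≢ : ∀ {i y} → y ≢ i → y ≢ suc i → (suc i <ᵇ y) ≡ (i <ᵇ y)
suc-<ᵇ-≢ {i} {y} y≢i y≢1+i with <-cmp i y
... | tri< i<y _ _ with <-cmp (suc i) y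
...   | tri< 1+i<y _ _ rewrite <ᵇ-true 1+i<y | <ᵇ-true i<y = refl
...   | tri≈ _ 1+i≡y _ = ⊥-elim (y≢1+i (sym 1+i≡y))
...   | tri> _ _ y<1+i = ⊥-elim (<⇒≱ i<y (≤-pred y<1+i))
suc-<ᵇ-≢ {i} {y} y≢i y≢1+i | tri≈ _ i≡y _ = ⊥-elim (y≢i (sym i≡y))
suc-<ᵇ-≢ {i} {y} y≢i y≢1+i | tri> _ _ y<i
  rewrite <ᵇ-false {i} {y} (<⇒≤ y<i) | <ᵇ-false {suc i} {y} (≤-trans (<⇒≤ y<i) (n≤1+n i)) = refl

<ᵇ-suc-≢ : ∀ {i x} → x ≢ i → x ≢ suc i → (x <ᵇ suc i) ≡ (x <ᵇ i)
<ᵇ-suc-≢ {i} {x} x≢i x≢1+i with <-cmp x i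
... | tri< x<i _ _ rewrite <ᵇ-true x<i | <ᵇ-true (≤-trans x<i (n≤1+n i)) = refl
... | tri≈ _ x≡i _ = ⊥-elim (x≢i x≡i)
... | tri> _ _ i<x rewrite <ᵇ-false {x} {i} (<⇒≤ i<x) = <ᵇ-false {x} {suc i} i<x

between-≤ : ∀ {a b} x → a ≤ b → x ≢ a → x ≢ b → between a x b ≡ (a <ᵇ x) xor (b <ᵇ x)
between-≤ {a} {b} x a≤b x≢a x≢b with <-cmp x a
... | tri< x<a _ _ rewrite <ᵇ-false {a} {x} (<⇒≤ x<a) | <ᵇ-false {b} {x} (≤-trans (<⇒≤ x<a) a≤b) = refl
... | tri≈ _ x≡a _ = ⊥-elim (x≢a x≡a)
... | tri> _ _ a<x rewrite <ᵇ-true a<x with <-cmp x b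
...   | tri< x<b _ _ rewrite <ᵇ-true x<b | <ᵇ-false {b} {x} (<⇒≤ x<b) = refl
...   | tri≈ _ x≡b _ = ⊥-elim (x≢b x≡b)
...   | tri> _ _ b<x rewrite <ᵇ-true b<x | <ᵇ-false {x} {b} (<⇒≤ b<x) = refl

between-⊓⊔ : ∀ a b x → x ≢ a → x ≢ b → between (a ⊓ b) x (a ⊔ b) ≡ (a <ᵇ x) xor (b <ᵇ x)
between-⊓⊔ a b x x≢a x≢b with ≤-total a b
... | inj₁ a≤b rewrite m≤n⇒m⊓n≡m a≤b | m≤n⇒m⊔n≡n a≤b = between-≤ x a≤b x≢a x≢b
... | inj₂ b≤a rewrite m≥n⇒m⊓n≡n b≤a | m≥n⇒m⊔n≡m b≤a | xor-comm (a <ᵇ x) (b <ᵇ x) = between-≤ x b≤a x≢b x≢a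

between-⊓⊔-left : ∀ a b → between (a ⊓ b) a (a ⊔ b) ≡ false
between-⊓⊔-left a b with ≤-total a b
... | inj₁ a≤b rewrite m≤n⇒m⊓n≡m a≤b | <ᵇ-irrefl a = refl
... | inj₂ b≤a rewrite m≥n⇒m⊔n≡m b≤a | <ᵇ-irrefl a = ∧-zeroʳ ((a ⊓ b) <ᵇ a)

between-⊓⊔-right : ∀ a b → between (a ⊓ b) b (a ⊔ b) ≡ false
between-⊓⊔-right a b rewrite ⊓-comm a b | ⊔-comm a b = between-⊓⊔-left b a

between-outside : ∀ {lo hi} x y z → between lo x hi ≡ true → between lo y hi ≡ true →
                  between lo z hi ≡ false → between (x ⊓ y) z (x ⊔ y) ≡ false
between-outside {lo} {hi} x y z x∈ y∈ z∉ with lo <ᵇ z in lo<ᵇz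
... | false = cong (_∧ (z <ᵇ x ⊔ y)) (<ᵇ-false (≤-trans (<ᵇ-false⇒≥ {lo} {z} lo<ᵇz) (<⇒≤ lo<x⊓y)))
  where
  lo<x⊓y : lo < x ⊓ y
  lo<x⊓y = ⊓-glb (<ᵇ-true⇒< (proj₁ (∧-true⇒ x∈))) (<ᵇ-true⇒< (proj₁ (∧-true⇒ y∈)))
... | true with z <ᵇ hi in z<ᵇhi
...   | false = trans (cong ((x ⊓ y <ᵇ z) ∧_) (<ᵇ-false (≤-trans (<⇒≤ x⊔y<hi) (<ᵇ-false⇒≥ {z} {hi} z<ᵇhi)))) (∧-zeroʳ _)
  where
  x⊔y<hi : x ⊔ y < hi
  x⊔y<hi = ⊔-lub (<ᵇ-true⇒< (proj₂ (∧-true⇒ {lo <ᵇ x} x∈))) (<ᵇ-true⇒< (proj₂ (∧-true⇒ {lo <ᵇ y} y∈)))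
between-outside x y z x∈ y∈ () | true | true

infix 6 _==_
_==_ : ∀ {m} → Fin m → Fin m → Bool
x == y = does (x ≟ y)

==-refl : ∀ {m} (x : Fin m) → x == x ≡ true
==-refl x with x ≟ x
... | yes _  = refl
... | no x≢x = ⊥-elim (x≢x refl)

==-false : ∀ {m} {x y : Fin m} → x ≢ y → x == y ≡ false
==-false {x = x} {y} x≢y with x ≟ y
... | yes x≡y = ⊥-elim (x≢y x≡y)
... | no _    = refl

==-exclusiveʳ : ∀ {m} (x : Fin m) {y z} → y ≢ z → (x == y) ∧ (x == z) ≡ false
==-exclusiveʳ x {y} {z} y≢z with x ≟ y
... | yes refl = ==-false y≢z
... | no _     = refl

==-exclusiveˡ : ∀ {m} {x y : Fin m} (z : Fin m) → x ≢ y → (x == z) ∧ (y == z) ≡ false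
==-exclusiveˡ {x = x} {y} z x≢y with x ≟ z
... | yes refl = ==-false (λ y≡x → x≢y (sym y≡x))
... | no _     = refl

∑-list : ∀ m (f : Fin m → ℕ) → ListAction.sum (map f (allFin m)) ≡ ∑ f
∑-list m f = trans (cong ListAction.sum (ListP.map-tabulate (λ a → a) f)) (∑-tabulate m f)
  where
  ∑-tabulate : ∀ m (g : Fin m → ℕ) → ListAction.sum (List.tabulate g) ≡ ∑ g
  ∑-tabulate zero    g = refl
  ∑-tabulate (suc m) g = cong (g Fin.zero +_) (∑-tabulate m (λ a → g (Fin.suc a)))

∑-mono-≤ : ∀ {m} {f g : Fin m → ℕ} → (∀ a → f a ≤ g a) → ∑ f ≤ ∑ g
∑-mono-≤ {zero}  f≤g = z≤n
∑-mono-≤ {suc m} f≤g = +-mono-≤ (f≤g Fin.zero) (∑-mono-≤ (λ a → f≤g (Fin.suc a)))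

∑-involution : ∀ {m} (σ : Fin m → Fin m) → (∀ a → σ (σ a) ≡ a) → (f : Fin m → ℕ) → ∑ (λ a → f (σ a)) ≡ ∑ f
∑-involution σ inv f = sym (sum-permute f (permutation σ σ inv inv))

∑-zero : ∀ {m} {f : Fin m → ℕ} → (∀ a → f a ≡ 0) → ∑ f ≡ 0
∑-zero {zero}  f≡0 = refl
∑-zero {suc m} f≡0 = cong₂ _+_ (f≡0 Fin.zero) (∑-zero (λ a → f≡0 (Fin.suc a)))

∑-𝟙-== : ∀ {m} (u : Fin m) → ∑ (λ a → 𝟙 (a == u)) ≡ 1
∑-𝟙-== {suc m} Fin.zero =
  cong₂ _+_ (cong 𝟙 (==-refl (Fin.zero {m}))) (∑-zero {m} {λ a → 𝟙 (Fin.suc a == Fin.zero)} (λ a → cong 𝟙 (==-false {x = Fin.suc a} {Fin.zero} λ ())))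
∑-𝟙-== {suc m} (Fin.suc u) = trans (sum-cong-≗ shift) (∑-𝟙-== u)
  where
  shift : ∀ a → 𝟙 (Fin.suc a == Fin.suc u) ≡ 𝟙 (a == u)
  shift a with a ≟ u
  ... | yes refl = refl
  ... | no _     = refl

∑-𝟙-pair : ∀ {m} (u v : Fin m) → u ≢ v → ∑ (λ a → 𝟙 ((a == u) ∨ (a == v))) ≡ 2
∑-𝟙-pair u v u≢v = begin
  ∑ (λ a → 𝟙 ((a == u) ∨ (a == v)))         ≡⟨ sum-cong-≗ split ⟩
  ∑ (λ a → 𝟙 (a == u) + 𝟙 (a == v))         ≡⟨ ∑-distrib-+ (λ a → 𝟙 (a == u)) (λ a → 𝟙 (a == v)) ⟩
  ∑ (λ a → 𝟙 (a == u)) + ∑ (λ a → 𝟙 (a == v)) ≡⟨ cong₂ _+_ (∑-𝟙-== u) (∑-𝟙-== v) ⟩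
  2                                            ∎
  where
  open ≡-Reasoning
  split : ∀ a → 𝟙 ((a == u) ∨ (a == v)) ≡ 𝟙 (a == u) + 𝟙 (a == v)
  split a = trans (cong 𝟙 (sym (xor-exclusive (a == u) (a == v) (==-exclusiveʳ a u≢v))))
                  (𝟙-xor-exclusive (a == u) (a == v) (==-exclusiveʳ a u≢v))

∑-𝟙-∧ : ∀ {m} (f g : Fin m → Bool) → ∑ (λ a → ∑ (λ b → 𝟙 (f a ∧ g b))) ≡ ∑ (λ a → 𝟙 (f a)) * ∑ (λ b → 𝟙 (g b))
∑-𝟙-∧ f g = begin
  ∑ (λ a → ∑ (λ b → 𝟙 (f a ∧ g b)))          ≡⟨ sum-cong-≗ (λ a → sum-cong-≗ λ b → 𝟙-∧ (f a) (g b)) ⟩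
  ∑ (λ a → ∑ (λ b → 𝟙 (f a) * 𝟙 (g b)))      ≡⟨ sum-cong-≗ (λ a → sym (*-distribˡ-sum (𝟙 (f a)) (λ b → 𝟙 (g b)))) ⟩
  ∑ (λ a → 𝟙 (f a) * ∑ (λ b → 𝟙 (g b)))      ≡⟨ sym (*-distribʳ-sum (∑ (λ b → 𝟙 (g b))) (λ a → 𝟙 (f a))) ⟩
  ∑ (λ a → 𝟙 (f a)) * ∑ (λ b → 𝟙 (g b))      ∎
  where open ≡-Reasoning

∑-fold : ∀ {m} (σ : Fin m → Fin m) → (∀ a → σ (σ a) ≡ a) → (up : Fin m → Bool) → (∀ a → up (σ a) ≡ not (up a)) →
  (f : Fin m → ℕ) → (∀ a → f (σ a) ≡ f a) → ∑ f ≡ 2 * ∑ (λ a → 𝟙 (up a) * f a)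
∑-fold σ σ-involutive up up-σ f f-σ = begin
  ∑ f                                                          ≡⟨ sum-cong-≗ split ⟩
  ∑ (λ a → 𝟙 (up a) * f a + 𝟙 (not (up a)) * f a)             ≡⟨ ∑-distrib-+ (λ a → 𝟙 (up a) * f a) _ ⟩
  upper + ∑ (λ a → 𝟙 (not (up a)) * f a)                       ≡⟨ cong (upper +_) lower≡upper ⟩
  upper + upper                                                ≡⟨ cong (upper +_) (sym (+-identityʳ upper)) ⟩
  2 * upper                                                    ∎
  where
  open ≡-Reasoning
  upper : ℕ
  upper = ∑ λ a → 𝟙 (up a) * f a
  split : ∀ a → f a ≡ 𝟙 (up a) * f a + 𝟙 (not (up a)) * f a
  split a with up a
  ... | true  = sym (trans (+-identityʳ _) (+-identityʳ (f a)))
  ... | false = sym (+-identityʳ (f a))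
  lower≡upper : ∑ (λ a → 𝟙 (not (up a)) * f a) ≡ upper
  lower≡upper = trans (sym (∑-involution σ σ-involutive (λ a → 𝟙 (not (up a)) * f a)))
                      (sum-cong-≗ λ a → cong₂ (λ x y → 𝟙 x * y) (trans (cong not (up-σ a)) (not-involutive (up a))) (f-σ a))

_∖_ : ∀ {m} → (Fin m → ℕ) → Fin m → Fin m → ℕ
(f ∖ u) a = if a == u then 0 else f a

∑-∖ : ∀ {m} (f : Fin m → ℕ) (u : Fin m) → ∑ f ≡ f u + ∑ (f ∖ u)
∑-∖ f u = begin
  ∑ f                                                 ≡⟨ sum-cong-≗ split ⟩
  ∑ (λ a → 𝟙 (a == u) * f u + (f ∖ u) a)             ≡⟨ ∑-distrib-+ (λ a → 𝟙 (a == u) * f u) (f ∖ u) ⟩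
  ∑ (λ a → 𝟙 (a == u) * f u) + ∑ (f ∖ u)             ≡⟨ cong (_+ ∑ (f ∖ u)) (sym (*-distribʳ-sum (f u) (λ a → 𝟙 (a == u)))) ⟩
  ∑ (λ a → 𝟙 (a == u)) * f u + ∑ (f ∖ u)             ≡⟨ cong (λ c → c * f u + ∑ (f ∖ u)) (∑-𝟙-== u) ⟩
  1 * f u + ∑ (f ∖ u)                                 ≡⟨ cong (_+ ∑ (f ∖ u)) (*-identityˡ (f u)) ⟩
  f u + ∑ (f ∖ u)                                     ∎
  where
  open ≡-Reasoning
  split : ∀ a → f a ≡ 𝟙 (a == u) * f u + (f ∖ u) a
  split a with a ≟ u
  ... | yes refl = sym (trans (+-identityʳ (f a + 0)) (+-identityʳ (f a)))
  ... | no _     = refl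

∖-≤ : ∀ {m} {f g : Fin m → ℕ} {u a : Fin m} → (a ≢ u → f a ≤ g a) → (f ∖ u) a ≤ (g ∖ u) a
∖-≤ {u = u} {a} f≤g with a ≟ u
... | yes _   = z≤n
... | no a≢u  = f≤g a≢u

∖-≡ : ∀ {m} {f g : Fin m → ℕ} {u a : Fin m} → (a ≢ u → f a ≡ g a) → (f ∖ u) a ≡ (g ∖ u) a
∖-≡ {u = u} {a} f≡g with a ≟ u
... | yes _   = refl
... | no a≢u  = f≡g a≢u

∖-≢ : ∀ {m} (f : Fin m → ℕ) {u a : Fin m} → a ≢ u → (f ∖ u) a ≡ f a
∖-≢ f a≢u rewrite ==-false a≢u = refl

-- The order of labels and the transposition of i and i + 1

infix 6 _≺_
_≺_ : ∀ {m} → Fin m → Fin m → Bool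
x ≺ y = toℕ x <ᵇ toℕ y

toℕ-≢ : ∀ {m} {x y : Fin m} → x ≢ y → toℕ x ≢ toℕ y
toℕ-≢ x≢y eq = x≢y (toℕ-injective eq)

≺-irrefl : ∀ {m} (x : Fin m) → x ≺ x ≡ false
≺-irrefl x = <ᵇ-irrefl (toℕ x)

≺-asym : ∀ {m} {x y : Fin m} → x ≢ y → y ≺ x ≡ not (x ≺ y)
≺-asym x≢y = <ᵇ-asym (toℕ-≢ x≢y)

zero≺ : ∀ {k} (y : Fin (suc k)) → y ≢ Fin.zero → Fin.zero ≺ y ≡ true
zero≺ Fin.zero    y≢0 = ⊥-elim (y≢0 refl)
zero≺ (Fin.suc y) y≢0 = refl

≺zero : ∀ {k} (y : Fin (suc k)) → y ≺ Fin.zero ≡ false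
≺zero y = <ᵇ-false {toℕ y} {0} z≤n

last≺ : ∀ {k} (u y : Fin (suc k)) → toℕ u ≡ k → u ≺ y ≡ false
last≺ {k} u y u≡k rewrite u≡k = <ᵇ-false {k} {toℕ y} (≤-pred (toℕ<n y))

≺last : ∀ {k} (u y : Fin (suc k)) → toℕ u ≡ k → y ≢ u → y ≺ u ≡ true
≺last {k} u y u≡k y≢u =
  <ᵇ-true (≤∧≢⇒< (subst (toℕ y ≤_) (sym u≡k) (≤-pred (toℕ<n y))) (toℕ-≢ y≢u))

transpose : ∀ {m} → Fin m → Fin m → Fin m → Fin m
transpose u v x = if x == u then v else (if x == v then u else x)

oneOf : ∀ {m} → Fin m → Fin m → Fin m → Bool
oneOf u v x = (x == u) ∨ (x == v)

swapsPair : ∀ {m} → Fin m → Fin m → Fin m → Fin m → Bool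
swapsPair u v x y = ((x == u) ∧ (y == v)) xor ((x == v) ∧ (y == u))

≺-transpose-adjacent : ∀ {m} (u v x y : Fin m) → toℕ v ≡ suc (toℕ u) →
  transpose u v x ≺ transpose u v y ≡ x ≺ y xor swapsPair u v x y
≺-transpose-adjacent u v x y v≡1+u with x ≟ u | x ≟ v | y ≟ u | y ≟ v
... | yes refl | yes x≡v | _ | _ = ⊥-elim (1+n≢n (sym (trans (cong toℕ x≡v) v≡1+u)))
... | _ | _ | yes refl | yes y≡v = ⊥-elim (1+n≢n (sym (trans (cong toℕ y≡v) v≡1+u)))
... | yes refl | no _ | yes refl | no _ rewrite ≺-irrefl u | ≺-irrefl v = refl
... | yes refl | no u≢v | no _ | yes refl rewrite ≺-asym u≢v = sym (xor-trueʳ _)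
... | yes refl | no _ | no y≢u | no y≢v rewrite v≡1+u =
  trans (suc-<ᵇ-≢ (toℕ-≢ y≢u) (λ eq → y≢v (toℕ-injective (trans eq (sym v≡1+u))))) (sym (xor-identityʳ _))
... | no v≢u | yes refl | yes refl | no _ rewrite ≺-asym v≢u = sym (xor-trueʳ _)
... | no _ | yes refl | no _ | yes refl rewrite ≺-irrefl u | ≺-irrefl v = refl
... | no _ | yes refl | no y≢u | no y≢v rewrite v≡1+u =
  trans (sym (suc-<ᵇ-≢ (toℕ-≢ y≢u) (λ eq → y≢v (toℕ-injective (trans eq (sym v≡1+u)))))) (sym (xor-identityʳ _))
... | no x≢u | no x≢v | yes refl | no _ rewrite v≡1+u =
  trans (<ᵇ-suc-≢ (toℕ-≢ x≢u) (λ eq → x≢v (toℕ-injective (trans eq (sym v≡1+u))))) (sym (xor-identityʳ _))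
... | no x≢u | no x≢v | no _ | yes refl rewrite v≡1+u =
  trans (sym (<ᵇ-suc-≢ (toℕ-≢ x≢u) (λ eq → x≢v (toℕ-injective (trans eq (sym v≡1+u)))))) (sym (xor-identityʳ _))
... | no _ | no _ | no _ | no _ = sym (xor-identityʳ (x ≺ y))

≺-transpose-last-first : ∀ {k} (u x y : Fin (suc k)) → toℕ u ≡ k → u ≢ Fin.zero →
  transpose u Fin.zero x ≺ transpose u Fin.zero y
    ≡ x ≺ y xor (oneOf u Fin.zero x xor (oneOf u Fin.zero y xor swapsPair u Fin.zero x y))
≺-transpose-last-first u x y u≡k u≢0 with x ≟ u | x ≟ Fin.zero | y ≟ u | y ≟ Fin.zero
... | yes refl | yes x≡0 | _ | _ = ⊥-elim (u≢0 x≡0)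
... | _ | _ | yes refl | yes y≡0 = ⊥-elim (u≢0 y≡0)
... | yes refl | no _ | yes refl | no _ rewrite ≺-irrefl u = refl
... | yes refl | no _ | no _ | yes refl rewrite ≺zero u | zero≺ u u≢0 = refl
... | yes refl | no _ | no _ | no y≢0 rewrite zero≺ y y≢0 | last≺ u y u≡k = refl
... | no _ | yes refl | yes refl | no _ rewrite ≺zero u | zero≺ u u≢0 = refl
... | no _ | yes refl | no _ | yes refl rewrite ≺-irrefl u = refl
... | no _ | yes refl | no _ | no y≢0 rewrite zero≺ y y≢0 | last≺ u y u≡k = refl
... | no x≢u | no _ | yes refl | no _ rewrite ≺zero x | ≺last u x u≡k x≢u = refl
... | no x≢u | no _ | no _ | yes refl rewrite ≺zero x | ≺last u x u≡k x≢u = refl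
... | no _ | no _ | no _ | no _ = sym (xor-identityʳ (x ≺ y))

wraps : ∀ {m} → Fin m → Bool
wraps i = toℕ (next i) ℕ.≡ᵇ 0

data NextView {k} (i : Fin (suc k)) : Set where
  last  : toℕ i ≡ k → next i ≡ Fin.zero → wraps i ≡ true → NextView i
  inner : toℕ (next i) ≡ suc (toℕ i) → wraps i ≡ false → NextView i

nextView : ∀ {k} (i : Fin (suc k)) → NextView i
nextView {k} i with k ℕ.≟ toℕ i in eq
... | yes k≡i = last (sym k≡i) next≡0 (cong (λ z → toℕ z ℕ.≡ᵇ 0) next≡0)
  where
  next≡0 : next i ≡ Fin.zero
  next≡0 rewrite eq = refl
... | no k≢i = inner toℕ-next (cong (ℕ._≡ᵇ 0) toℕ-next)
  where
  toℕ-next : toℕ (next i) ≡ suc (toℕ i)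
  toℕ-next rewrite eq = cong suc (toℕ-lower₁ i k≢i)

swapAt-i : ∀ {m} (i : Fin m) → swapAt i i ≡ next i
swapAt-i i rewrite ==-refl i = refl

swapAt-next : ∀ {m} (i : Fin m) → i ≢ next i → swapAt i (next i) ≡ i
swapAt-next i i≢next rewrite ==-false (λ next≡i → i≢next (sym next≡i)) | ==-refl (next i) = refl

swapAt-other : ∀ {m} (i x : Fin m) → x ≢ i → x ≢ next i → swapAt i x ≡ x
swapAt-other i x x≢i x≢next rewrite ==-false x≢i | ==-false x≢next = refl

swapAt-involutive : ∀ {m} (i x : Fin m) → swapAt i (swapAt i x) ≡ x
swapAt-involutive i x with x ≟ i
... | yes refl with next x ≟ x
...   | yes next≡x = next≡x
...   | no _ rewrite ==-refl (next x) = refl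
swapAt-involutive i x | no x≢i with x ≟ next i
...   | yes refl rewrite ==-refl i = refl
...   | no x≢next rewrite ==-false x≢i | ==-false x≢next = refl

swapAt-injective : ∀ {m} (i : Fin m) {x y : Fin m} → x ≢ y → swapAt i x ≢ swapAt i y
swapAt-injective i {x} {y} x≢y eq =
  x≢y (trans (sym (swapAt-involutive i x)) (trans (cong (swapAt i) eq) (swapAt-involutive i y)))

-- s_i reverses only the order of i and i + 1, unless i + 1 wraps around to 0: then i and 0 also
-- change order with every other label. These extra terms involve one label at a time and cancel
-- in crosses-swapAt.
≺-swapAt : ∀ {k} (i x y : Fin (suc k)) → i ≢ next i →
  swapAt i x ≺ swapAt i y
    ≡ x ≺ y xor ((wraps i ∧ oneOf i (next i) x) xor ((wraps i ∧ oneOf i (next i) y) xor swapsPair i (next i) x y))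
≺-swapAt i x y i≢next with nextView i
... | last i≡k next≡0 wraps≡true rewrite wraps≡true =
  subst (λ v → transpose i v x ≺ transpose i v y ≡ x ≺ y xor (oneOf i v x xor (oneOf i v y xor swapsPair i v x y)))
        (sym next≡0) (≺-transpose-last-first i x y i≡k (λ i≡0 → i≢next (trans i≡0 (sym next≡0))))
... | inner toℕ-next wraps≡false rewrite wraps≡false = ≺-transpose-adjacent i (next i) x y toℕ-next

next≺ : ∀ {k} (i z : Fin (suc k)) → i ≢ next i → z ≢ i → z ≢ next i → next i ≺ z ≡ (i ≺ z) xor wraps i
next≺ i z i≢n z≢i z≢n =
  trans (sym (cong₂ _≺_ (swapAt-i i) (swapAt-other i z z≢i z≢n))) (trans (≺-swapAt i i z i≢n) (cong ((i ≺ z) xor_) wrap-term))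
  where
  wrap-term : (wraps i ∧ oneOf i (next i) i) xor ((wraps i ∧ oneOf i (next i) z) xor swapsPair i (next i) i z) ≡ wraps i
  wrap-term rewrite ==-refl i | ==-false z≢i | ==-false z≢n | ==-false i≢n with wraps i
  ... | true  = refl
  ... | false = refl

-- Crossing chords

record Distinct₄ {m} (a a' b b' : Fin m) : Set where
  constructor distinct₄
  field
    a≢a'  : a ≢ a'
    b≢b'  : b ≢ b'
    b≢a   : b ≢ a
    b≢a'  : b ≢ a'
    b'≢a  : b' ≢ a
    b'≢a' : b' ≢ a'

Distinct₄-sym : ∀ {m} {a a' b b' : Fin m} → Distinct₄ a a' b b' → Distinct₄ b b' a a'
Distinct₄-sym d = record
  { a≢a' = b≢b' ; b≢b' = a≢a' ; b≢a = ≢-sym b≢a ; b≢a' = ≢-sym b'≢a ; b'≢a = ≢-sym b≢a' ; b'≢a' = ≢-sym b'≢a' }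
  where open Distinct₄ d

Distinct₄-swapAt : ∀ {m} (i : Fin m) {a a' b b' : Fin m} → Distinct₄ a a' b b' →
  Distinct₄ (swapAt i a) (swapAt i a') (swapAt i b) (swapAt i b')
Distinct₄-swapAt i d = record
  { a≢a' = s a≢a' ; b≢b' = s b≢b' ; b≢a = s b≢a ; b≢a' = s b≢a' ; b'≢a = s b'≢a ; b'≢a' = s b'≢a' }
  where
  open Distinct₄ d
  s = swapAt-injective i

crosses-≺ : ∀ {m} {a a' b b' : Fin m} → b ≢ a → b ≢ a' → b' ≢ a → b' ≢ a' →
  crosses a a' b b' ≡ ((a ≺ b) xor (a' ≺ b)) xor ((a ≺ b') xor (a' ≺ b'))
crosses-≺ {a = a} {a'} {b} {b'} b≢a b≢a' b'≢a b'≢a' =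
  cong₂ _xor_ (between-⊓⊔ (toℕ a) (toℕ a') (toℕ b) (toℕ-≢ b≢a) (toℕ-≢ b≢a'))
              (between-⊓⊔ (toℕ a) (toℕ a') (toℕ b') (toℕ-≢ b'≢a) (toℕ-≢ b'≢a'))

crosses-self : ∀ {m} (a a' : Fin m) → crosses a a' a a' ≡ false
crosses-self a a' rewrite between-⊓⊔-left (toℕ a) (toℕ a') | between-⊓⊔-right (toℕ a) (toℕ a') = refl

crosses-self-reversed : ∀ {m} (a a' : Fin m) → crosses a a' a' a ≡ false
crosses-self-reversed a a' rewrite between-⊓⊔-left (toℕ a) (toℕ a') | between-⊓⊔-right (toℕ a) (toℕ a') = refl

crosses-flipˡ : ∀ {m} (a a' b b' : Fin m) → crosses a a' b b' ≡ crosses a' a b b'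
crosses-flipˡ a a' b b' rewrite ⊓-comm (toℕ a) (toℕ a') | ⊔-comm (toℕ a) (toℕ a') = refl

crosses-flipʳ : ∀ {m} (a a' b b' : Fin m) → crosses a a' b b' ≡ crosses a a' b' b
crosses-flipʳ a a' b b' = xor-comm (between (toℕ a ⊓ toℕ a') (toℕ b) (toℕ a ⊔ toℕ a')) _

crosses-sym : ∀ {m} {a a' b b' : Fin m} → Distinct₄ a a' b b' → crosses a a' b b' ≡ crosses b b' a a'
crosses-sym {a = a} {a'} {b} {b'} (distinct₄ _ _ b≢a b≢a' b'≢a b'≢a')
  rewrite crosses-≺ b≢a b≢a' b'≢a b'≢a' | crosses-≺ (≢-sym b≢a) (≢-sym b'≢a) (≢-sym b≢a') (≢-sym b'≢a')
        | ≺-asym b≢a | ≺-asym b≢a' | ≺-asym b'≢a | ≺-asym b'≢a'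
  = truth-table 4 (λ w x y z → (not w xor not x) xor (not y xor not z)) (λ w x y z → (w xor y) xor (x xor z))
                  (b ≺ a) (b ≺ a') (b' ≺ a) (b' ≺ a')

hasEnd : ∀ {m} → Fin m → Fin m → Fin m → Bool
hasEnd a a' u = (a == u) ∨ (a' == u)

hasEnd-true⇒ : ∀ {m} {a a' u : Fin m} → hasEnd a a' u ≡ true → a ≡ u ⊎ a' ≡ u
hasEnd-true⇒ {a = a} {a'} {u} h with a ≟ u | a' ≟ u
... | yes a≡u | _        = inj₁ a≡u
... | no _    | yes a'≡u = inj₂ a'≡u

hasEnd-self : ∀ {m} (a a' : Fin m) → hasEnd a a' a ≡ true
hasEnd-self a a' rewrite ==-refl a = refl

hasEnd-partner : ∀ {m} (a a' : Fin m) → hasEnd a a' a' ≡ true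
hasEnd-partner a a' rewrite ==-refl a' = ∨-zeroʳ (a == a')

splits : ∀ {m} → Fin m → Fin m → Fin m → Fin m → Fin m → Fin m → Bool
splits u v a a' b b' = (hasEnd a a' u ∧ hasEnd b b' v) xor (hasEnd a a' v ∧ hasEnd b b' u)

swapsPair-parity : ∀ {m} (u v : Fin m) {a a' b b' : Fin m} → a ≢ a' → b ≢ b' →
  (swapsPair u v a b xor swapsPair u v a' b) xor (swapsPair u v a b' xor swapsPair u v a' b') ≡ splits u v a a' b b'
swapsPair-parity u v {a} {a'} {b} {b'} a≢a' b≢b' = begin
  (swapsPair u v a b xor swapsPair u v a' b) xor (swapsPair u v a b' xor swapsPair u v a' b')
    ≡⟨ truth-table 8
         (λ au a'u av a'v bu b'u bv b'v →
            (((au ∧ bv) xor (av ∧ bu)) xor ((a'u ∧ bv) xor (a'v ∧ bu)))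
              xor (((au ∧ b'v) xor (av ∧ b'u)) xor ((a'u ∧ b'v) xor (a'v ∧ b'u))))
         (λ au a'u av a'v bu b'u bv b'v → ((au xor a'u) ∧ (bv xor b'v)) xor ((av xor a'v) ∧ (bu xor b'u)))
         (a == u) (a' == u) (a == v) (a' == v) (b == u) (b' == u) (b == v) (b' == v) ⟩
  ((a ⊕ a' at u) ∧ (b ⊕ b' at v)) xor ((a ⊕ a' at v) ∧ (b ⊕ b' at u))
    ≡⟨ cong₂ _xor_ (cong₂ _∧_ (hasEnd-xor a≢a' u) (hasEnd-xor b≢b' v)) (cong₂ _∧_ (hasEnd-xor a≢a' v) (hasEnd-xor b≢b' u)) ⟩
  splits u v a a' b b' ∎
  where
  open ≡-Reasoning
  _⊕_at_ : Fin _ → Fin _ → Fin _ → Bool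
  x ⊕ x' at w = (x == w) xor (x' == w)
  hasEnd-xor : ∀ {x x'} → x ≢ x' → ∀ w → x ⊕ x' at w ≡ hasEnd x x' w
  hasEnd-xor {x} {x'} x≢x' w = xor-exclusive (x == w) (x' == w) (==-exclusiveˡ w x≢x')

crosses-swapAt : ∀ {k} (i : Fin (suc k)) → i ≢ next i → {a a' b b' : Fin (suc k)} → Distinct₄ a a' b b' →
  crosses (swapAt i a) (swapAt i a') (swapAt i b) (swapAt i b') ≡ crosses a a' b b' xor splits i (next i) a a' b b'
crosses-swapAt i i≢next {a} {a'} {b} {b'} d@(distinct₄ a≢a' b≢b' b≢a b≢a' b'≢a b'≢a')
  with Distinct₄-swapAt i d
... | distinct₄ _ _ sb≢sa sb≢sa' sb'≢sa sb'≢sa'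
  rewrite crosses-≺ sb≢sa sb≢sa' sb'≢sa sb'≢sa' | crosses-≺ b≢a b≢a' b'≢a b'≢a'
        | ≺-swapAt i a b i≢next | ≺-swapAt i a' b i≢next | ≺-swapAt i a b' i≢next | ≺-swapAt i a' b' i≢next
  = trans (truth-table 12
             (λ l₁ l₂ l₃ l₄ wa wa' wb wb' e₁ e₂ e₃ e₄ →
                ((l₁ xor (wa xor (wb xor e₁))) xor (l₂ xor (wa' xor (wb xor e₂))))
                  xor ((l₃ xor (wa xor (wb' xor e₃))) xor (l₄ xor (wa' xor (wb' xor e₄)))))
             (λ l₁ l₂ l₃ l₄ wa wa' wb wb' e₁ e₂ e₃ e₄ → ((l₁ xor l₂) xor (l₃ xor l₄)) xor ((e₁ xor e₂) xor (e₃ xor e₄)))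
             (a ≺ b) (a' ≺ b) (a ≺ b') (a' ≺ b') (w a) (w a') (w b) (w b')
             (swapsPair i (next i) a b) (swapsPair i (next i) a' b) (swapsPair i (next i) a b') (swapsPair i (next i) a' b'))
          (cong ((((a ≺ b) xor (a' ≺ b)) xor ((a ≺ b') xor (a' ≺ b'))) xor_) (swapsPair-parity i (next i) a≢a' b≢b'))
  where
  w : Fin _ → Bool
  w x = wraps i ∧ oneOf i (next i) x

crosses-adjacent : ∀ {k} (i : Fin (suc k)) {z w : Fin (suc k)} → i ≢ next i →
  z ≢ i → z ≢ next i → w ≢ i → w ≢ next i → crosses i (next i) z w ≡ false
crosses-adjacent i {z} {w} i≢n z≢i z≢n w≢i w≢n
  rewrite crosses-≺ z≢i z≢n w≢i w≢n | next≺ i z i≢n z≢i z≢n | next≺ i w i≢n w≢i w≢n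
  = truth-table 3 (λ x y c → (x xor (x xor c)) xor (y xor (y xor c))) (λ _ _ _ → false) (i ≺ z) (i ≺ w) (wraps i)

-- Perfect matchings and their crossings

infixl 9 _!_
_!_ : ∀ {m} → Mat m → Fin m → Fin m
τ ! j = lookup τ j

Mat-ext : ∀ {m} {τ η : Mat m} → (∀ j → τ ! j ≡ η ! j) → τ ≡ η
Mat-ext {τ = τ} {η} τ≗η = trans (sym (tabulate∘lookup τ)) (trans (tabulate-cong τ≗η) (tabulate∘lookup η))

-- A record rather than IsPerfectMatching itself, so that τ can be inferred from the proof.
record Perfect {m} (τ : Mat m) : Set where
  constructor perfect
  field isPerfectMatching : IsPerfectMatching τ

!-involutive : ∀ {m} {τ : Mat m} → Perfect τ → ∀ a → τ ! (τ ! a) ≡ a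
!-involutive (perfect pm) a = proj₁ (pm a)

!-≢ : ∀ {m} {τ : Mat m} → Perfect τ → ∀ a → τ ! a ≢ a
!-≢ (perfect pm) a = proj₂ (pm a)

!-injective : ∀ {m} {τ : Mat m} → Perfect τ → ∀ {a b} → τ ! a ≡ τ ! b → a ≡ b
!-injective {τ = τ} perf {a} {b} eq = trans (sym (!-involutive perf a)) (trans (cong (τ !_) eq) (!-involutive perf b))

!-flip : ∀ {m} {τ : Mat m} → Perfect τ → ∀ {a b} → τ ! a ≡ b → τ ! b ≡ a
!-flip {τ = τ} perf {a} refl = !-involutive perf a

!-== : ∀ {m} {τ : Mat m} → Perfect τ → ∀ a b → (τ ! a == b) ≡ (a == τ ! b)
!-== {τ = τ} perf a b with τ ! a ≟ b | a ≟ τ ! b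
... | yes _      | yes _      = refl
... | no _       | no _       = refl
... | yes τa≡b   | no a≢τb    = ⊥-elim (a≢τb (sym (!-flip perf τa≡b)))
... | no τa≢b    | yes a≡τb   = ⊥-elim (τa≢b (!-flip perf (sym a≡τb)))

data Relative {m} (τ : Mat m) (a b : Fin m) : Set where
  same    : b ≡ a → Relative τ a b
  partner : b ≡ τ ! a → Relative τ a b
  apart   : Distinct₄ a (τ ! a) b (τ ! b) → Relative τ a b

relative : ∀ {m} {τ : Mat m} → Perfect τ → ∀ a b → Relative τ a b
relative {τ = τ} perf a b with b ≟ a | b ≟ τ ! a
... | yes b≡a | _        = same b≡a
... | no _    | yes b≡τa = partner b≡τa
... | no b≢a  | no b≢τa  = apart (distinct₄ (≢-sym (!-≢ perf a)) (≢-sym (!-≢ perf b)) b≢a b≢τa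
                                            (λ τb≡a → b≢τa (sym (!-flip perf τb≡a)))
                                            (λ τb≡τa → b≢a (!-injective perf τb≡τa)))

crossing : ∀ {m} → Mat m → Fin m → Fin m → Bool
crossing τ a b = crosses a (τ ! a) b (τ ! b)

crossing-self : ∀ {m} (τ : Mat m) a → crossing τ a a ≡ false
crossing-self τ a = crosses-self a (τ ! a)

crossing-partner : ∀ {m} {τ : Mat m} → Perfect τ → ∀ a → crossing τ a (τ ! a) ≡ false
crossing-partner {τ = τ} perf a = trans (cong (crosses a (τ ! a) (τ ! a)) (!-involutive perf a)) (crosses-self-reversed a (τ ! a))

crossing-sym : ∀ {m} {τ : Mat m} → Perfect τ → ∀ a b → crossing τ a b ≡ crossing τ b a
crossing-sym {τ = τ} perf a b with relative perf a b
... | same refl    = refl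
... | partner refl = trans (crossing-partner perf a) (sym (trans (cong (crossing τ (τ ! a)) (sym (!-involutive perf a))) (crossing-partner perf (τ ! a))))
... | apart d      = crosses-sym d

crossing-partnerˡ : ∀ {m} {τ : Mat m} → Perfect τ → ∀ a b → crossing τ (τ ! a) b ≡ crossing τ a b
crossing-partnerˡ {τ = τ} perf a b =
  trans (cong (λ c → crosses (τ ! a) c b (τ ! b)) (!-involutive perf a)) (sym (crosses-flipˡ a (τ ! a) b (τ ! b)))

crossing-partnerʳ : ∀ {m} {τ : Mat m} → Perfect τ → ∀ a b → crossing τ a (τ ! b) ≡ crossing τ a b
crossing-partnerʳ {τ = τ} perf a b =
  trans (cong (crosses a (τ ! a) (τ ! b)) (!-involutive perf b)) (sym (crosses-flipʳ a (τ ! a) b (τ ! b)))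

crossing⇒Distinct₄ : ∀ {m} {τ : Mat m} → Perfect τ → ∀ {a b} → crossing τ a b ≡ true → Distinct₄ a (τ ! a) b (τ ! b)
crossing⇒Distinct₄ {τ = τ} perf {a} {b} a⋈b with relative perf a b
... | same refl    = ⊥-elim (true≢false (trans (sym a⋈b) (crossing-self τ a)))
... | partner refl = ⊥-elim (true≢false (trans (sym a⋈b) (crossing-partner perf a)))
... | apart d      = d

crossings : ∀ {m} → Mat m → ℕ
crossings τ = ∑ λ a → ∑ λ b → 𝟙 (crossing τ a b)

lowerEnd : ∀ {m} → Mat m → Fin m → Bool
lowerEnd τ a = a ≺ τ ! a

lowerEnd-partner : ∀ {m} {τ : Mat m} → Perfect τ → ∀ a → lowerEnd τ (τ ! a) ≡ not (lowerEnd τ a)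
lowerEnd-partner {τ = τ} perf a = trans (cong ((τ ! a) ≺_) (!-involutive perf a)) (≺-asym (≢-sym (!-≢ perf a)))

∑-lowerEnds≡2*crossingNumber : ∀ {m} {τ : Mat m} → Perfect τ →
  ∑ (λ a → ∑ (λ b → 𝟙 (lowerEnd τ a ∧ lowerEnd τ b ∧ crossing τ a b))) ≡ crossingNumber τ + crossingNumber τ
∑-lowerEnds≡2*crossingNumber {m} {τ} perf = begin
  ∑ (λ a → ∑ (unordered a))                                 ≡⟨ sum-cong-≗ (λ a → trans (sum-cong-≗ (split a)) (∑-distrib-+ (ordered a) _)) ⟩
  ∑ (λ a → ∑ (ordered a) + ∑ (λ b → ordered b a))          ≡⟨ ∑-distrib-+ (λ a → ∑ (ordered a)) _ ⟩
  ∑ (λ a → ∑ (ordered a)) + ∑ (λ a → ∑ (λ b → ordered b a)) ≡⟨ cong (∑ (λ a → ∑ (ordered a)) +_) (sym (∑-comm ordered)) ⟩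
  ∑ (λ a → ∑ (ordered a)) + ∑ (λ a → ∑ (ordered a))         ≡⟨ cong₂ _+_ (sym crossingNumber-∑) (sym crossingNumber-∑) ⟩
  crossingNumber τ + crossingNumber τ                        ∎
  where
  open ≡-Reasoning
  unordered ordered : Fin m → Fin m → ℕ
  unordered a b = 𝟙 (lowerEnd τ a ∧ lowerEnd τ b ∧ crossing τ a b)
  ordered a b = 𝟙 (lowerEnd τ a ∧ lowerEnd τ b ∧ (a ≺ b) ∧ crossing τ a b)
  split : ∀ a b → unordered a b ≡ ordered a b + ordered b a
  split a b with a ≟ b
  ... | yes refl rewrite crossing-self τ a | ≺-irrefl a with lowerEnd τ a
  ...   | true  = refl
  ...   | false = refl
  split a b | no a≢b rewrite ≺-asym a≢b | crossing-sym perf b a = 𝟙-split (lowerEnd τ a) (lowerEnd τ b) (a ≺ b) (crossing τ a b)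
  crossingNumber-∑ : crossingNumber τ ≡ ∑ (λ a → ∑ (ordered a))
  crossingNumber-∑ = trans (∑-list m _) (sum-cong-≗ λ a → ∑-list m (ordered a))

-- Each crossing of two chords is counted 2 · 2 · 2 times by crossings: once for each order of
-- the two chords and each choice of an endpoint on either chord.
crossings≡8*crossingNumber : ∀ {m} {τ : Mat m} → Perfect τ → crossings τ ≡ 8 * crossingNumber τ
crossings≡8*crossingNumber {m} {τ} perf = begin
  crossings τ
    ≡⟨ ∑-fold (τ !_) (!-involutive perf) (lowerEnd τ) (lowerEnd-partner perf) _
              (λ a → sum-cong-≗ λ b → cong 𝟙 (crossing-partnerˡ perf a b)) ⟩
  2 * ∑ (λ a → 𝟙 (lowerEnd τ a) * ∑ (λ b → 𝟙 (crossing τ a b)))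
    ≡⟨ cong (2 *_) (sum-cong-≗ λ a → cong (𝟙 (lowerEnd τ a) *_)
         (∑-fold (τ !_) (!-involutive perf) (lowerEnd τ) (lowerEnd-partner perf) _ (λ b → cong 𝟙 (crossing-partnerʳ perf a b)))) ⟩
  2 * ∑ (λ a → 𝟙 (lowerEnd τ a) * (2 * ∑ (λ b → 𝟙 (lowerEnd τ b) * 𝟙 (crossing τ a b))))
    ≡⟨ cong (2 *_) (trans (sum-cong-≗ pull-out) (sym (*-distribˡ-sum 2 (λ a → ∑ (unordered a))))) ⟩
  2 * (2 * ∑ (λ a → ∑ (unordered a)))
    ≡⟨ cong (λ c → 2 * (2 * c)) (∑-lowerEnds≡2*crossingNumber perf) ⟩
  2 * (2 * (crossingNumber τ + crossingNumber τ))
    ≡⟨ solve 1 (λ c → con 2 :* (con 2 :* (c :+ c)) := con 8 :* c) refl (crossingNumber τ) ⟩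
  8 * crossingNumber τ ∎
  where
  open ≡-Reasoning
  open +-*-Solver
  unordered : Fin m → Fin m → ℕ
  unordered a b = 𝟙 (lowerEnd τ a ∧ lowerEnd τ b ∧ crossing τ a b)
  pull-out : ∀ a → 𝟙 (lowerEnd τ a) * (2 * ∑ (λ b → 𝟙 (lowerEnd τ b) * 𝟙 (crossing τ a b))) ≡ 2 * ∑ (unordered a)
  pull-out a with lowerEnd τ a
  ... | false = sym (cong (2 *_) (∑-zero {m} {λ _ → 0} λ _ → refl))
  ... | true  = trans (+-identityʳ _) (cong (2 *_) (sum-cong-≗ λ b → sym (𝟙-∧ (lowerEnd τ b) (crossing τ a b))))

crossingNumber-suc : ∀ {m} {σ τ : Mat m} → Perfect σ → Perfect τ →
  crossings σ + 8 ≡ crossings τ → suc (crossingNumber σ) ≡ crossingNumber τ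
crossingNumber-suc {σ = σ} {τ} perfσ perfτ eq = *-cancelˡ-≡ (suc (crossingNumber σ)) (crossingNumber τ) 8 (begin
  8 * suc (crossingNumber σ)   ≡⟨ *-suc 8 (crossingNumber σ) ⟩
  8 + 8 * crossingNumber σ     ≡⟨ +-comm 8 (8 * crossingNumber σ) ⟩
  8 * crossingNumber σ + 8     ≡⟨ cong (_+ 8) (sym (crossings≡8*crossingNumber perfσ)) ⟩
  crossings σ + 8              ≡⟨ eq ⟩
  crossings τ                  ≡⟨ crossings≡8*crossingNumber perfτ ⟩
  8 * crossingNumber τ         ∎)
  where open ≡-Reasoning

crossings-+8 : ∀ {m} {σ τ : Mat m} → Perfect σ → Perfect τ →
  suc (crossingNumber σ) ≡ crossingNumber τ → crossings σ + 8 ≡ crossings τ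
crossings-+8 {σ = σ} {τ} perfσ perfτ eq = begin
  crossings σ + 8              ≡⟨ cong (_+ 8) (crossings≡8*crossingNumber perfσ) ⟩
  8 * crossingNumber σ + 8     ≡⟨ +-comm (8 * crossingNumber σ) 8 ⟩
  8 + 8 * crossingNumber σ     ≡⟨ sym (*-suc 8 (crossingNumber σ)) ⟩
  8 * suc (crossingNumber σ)   ≡⟨ cong (8 *_) eq ⟩
  8 * crossingNumber τ         ≡⟨ sym (crossings≡8*crossingNumber perfτ) ⟩
  crossings τ                  ∎
  where open ≡-Reasoning

-- The action of s_i

act-! : ∀ {m} (i : Fin m) (τ : Mat m) j → act i τ ! j ≡ swapAt i (τ ! swapAt i j)
act-! i τ j = lookup∘tabulate (λ j → swapAt i (τ ! swapAt i j)) j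

act-!-swapAt : ∀ {m} (i : Fin m) (τ : Mat m) j → act i τ ! swapAt i j ≡ swapAt i (τ ! j)
act-!-swapAt i τ j = trans (act-! i τ (swapAt i j)) (cong (λ x → swapAt i (τ ! x)) (swapAt-involutive i j))

act-involutive : ∀ {m} (i : Fin m) (τ : Mat m) → act i (act i τ) ≡ τ
act-involutive i τ = Mat-ext λ j →
  trans (act-! i (act i τ) j) (trans (cong (swapAt i) (act-!-swapAt i τ j)) (swapAt-involutive i (τ ! j)))

act-perfect : ∀ {m} (i : Fin m) {τ : Mat m} → Perfect τ → Perfect (act i τ)
act-perfect i {τ} perf = perfect λ j → involutive j , fixpoint-free j
  where
  involutive : ∀ j → act i τ ! (act i τ ! j) ≡ j
  involutive j = begin
    act i τ ! (act i τ ! j)                 ≡⟨ cong (act i τ !_) (act-! i τ j) ⟩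
    act i τ ! swapAt i (τ ! swapAt i j)     ≡⟨ act-!-swapAt i τ (τ ! swapAt i j) ⟩
    swapAt i (τ ! (τ ! swapAt i j))         ≡⟨ cong (swapAt i) (!-involutive perf (swapAt i j)) ⟩
    swapAt i (swapAt i j)                   ≡⟨ swapAt-involutive i j ⟩
    j                                       ∎
    where open ≡-Reasoning
  fixpoint-free : ∀ j → act i τ ! j ≢ j
  fixpoint-free j eq = !-≢ perf (swapAt i j)
    (trans (sym (swapAt-involutive i _)) (cong (swapAt i) (trans (sym (act-! i τ j)) eq)))

next-≢ : ∀ {k} {τ : Mat (suc k)} → Perfect τ → (i : Fin (suc k)) → i ≢ next i
next-≢ {k} {τ} perf i i≡next with nextView i
... | inner toℕ-next _ = 1+n≢n (sym (trans (cong toℕ i≡next) toℕ-next))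
... | last i≡k next≡0 _ = !-≢ perf i (toℕ-injective (trans (toℕ≡0 (τ ! i)) (sym (toℕ≡0 i))))
  where
  k≡0 : k ≡ 0
  k≡0 = trans (sym i≡k) (cong toℕ (trans i≡next next≡0))
  toℕ≡0 : (x : Fin (suc k)) → toℕ x ≡ 0
  toℕ≡0 x = n≤0⇒n≡0 (subst (toℕ x ≤_) k≡0 (≤-pred (toℕ<n x)))

Distinct₄-act : ∀ {m} {τ : Mat m} (i : Fin m) {a b} → Distinct₄ a (τ ! a) b (τ ! b) →
  Distinct₄ (swapAt i a) (act i τ ! swapAt i a) (swapAt i b) (act i τ ! swapAt i b)
Distinct₄-act {τ = τ} i {a} {b} d =
  subst₂ (λ x y → Distinct₄ (swapAt i a) x (swapAt i b) y) (sym (act-!-swapAt i τ a)) (sym (act-!-swapAt i τ b)) (Distinct₄-swapAt i d)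

crossing-act : ∀ {k} {τ : Mat (suc k)} → Perfect τ → (i : Fin (suc k)) → {a b : Fin (suc k)} →
  Distinct₄ a (τ ! a) b (τ ! b) →
  crossing (act i τ) (swapAt i a) (swapAt i b) ≡ crossing τ a b xor splits i (next i) a (τ ! a) b (τ ! b)
crossing-act {τ = τ} perf i {a} {b} d =
  trans (cong₂ (λ x y → crosses (swapAt i a) x (swapAt i b) y) (act-!-swapAt i τ a) (act-!-swapAt i τ b))
        (crosses-swapAt i (next-≢ perf i) d)

-- Resolving a crossing

rewire-! : ∀ {m} (τ : Mat m) a b j → rewire τ a b ! j ≡
  (if j == a then b else if j == b then a else if j == τ ! a then τ ! b else if j == τ ! b then τ ! a else τ ! j)
rewire-! τ a b j = lookup∘tabulate _ j

module Rewire {m} {τ : Mat m} {p q : Fin m} (d : Distinct₄ p (τ ! p) q (τ ! q)) where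
  open Distinct₄ d

  rewire-p : rewire τ p q ! p ≡ q
  rewire-p rewrite rewire-! τ p q p | ==-refl p = refl

  rewire-q : rewire τ p q ! q ≡ p
  rewire-q rewrite rewire-! τ p q q | ==-false b≢a | ==-refl q = refl

  rewire-τp : rewire τ p q ! (τ ! p) ≡ τ ! q
  rewire-τp rewrite rewire-! τ p q (τ ! p) | ==-false (≢-sym a≢a') | ==-false (≢-sym b≢a') | ==-refl (τ ! p) = refl

  rewire-τq : rewire τ p q ! (τ ! q) ≡ τ ! p
  rewire-τq rewrite rewire-! τ p q (τ ! q) | ==-false b'≢a | ==-false (≢-sym b≢b') | ==-false b'≢a' | ==-refl (τ ! q) = refl

  rewire-other : ∀ {j} → j ≢ p → j ≢ τ ! p → j ≢ q → j ≢ τ ! q → rewire τ p q ! j ≡ τ ! j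
  rewire-other {j} j≢p j≢τp j≢q j≢τq rewrite rewire-! τ p q j | ==-false j≢p | ==-false j≢q | ==-false j≢τp | ==-false j≢τq = refl

  data Position (j : Fin m) : Set where
    at-p      : j ≡ p → Position j
    at-τp     : j ≡ τ ! p → Position j
    at-q      : j ≡ q → Position j
    at-τq     : j ≡ τ ! q → Position j
    elsewhere : j ≢ p → j ≢ τ ! p → j ≢ q → j ≢ τ ! q → Position j

  position : ∀ j → Position j
  position j with j ≟ p | j ≟ τ ! p | j ≟ q | j ≟ τ ! q
  ... | yes j≡p | _        | _       | _        = at-p j≡p
  ... | no _    | yes j≡τp | _       | _        = at-τp j≡τp
  ... | no _    | no _     | yes j≡q | _        = at-q j≡q
  ... | no _    | no _     | no _    | yes j≡τq = at-τq j≡τq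
  ... | no j≢p  | no j≢τp  | no j≢q  | no j≢τq  = elsewhere j≢p j≢τp j≢q j≢τq

  elsewhere-partner : Perfect τ → ∀ {j} → j ≢ p → j ≢ τ ! p → j ≢ q → j ≢ τ ! q →
    (τ ! j ≢ p) × (τ ! j ≢ τ ! p) × (τ ! j ≢ q) × (τ ! j ≢ τ ! q)
  elsewhere-partner perf {j} j≢p j≢τp j≢q j≢τq =
    (λ τj≡p → j≢τp (sym (!-flip perf τj≡p))) , (λ τj≡τp → j≢p (!-injective perf τj≡τp)) ,
    (λ τj≡q → j≢τq (sym (!-flip perf τj≡q))) , (λ τj≡τq → j≢q (!-injective perf τj≡τq))

  rewire-perfect : Perfect τ → Perfect (rewire τ p q)
  rewire-perfect perf = perfect λ j → involutive j (position j) , fixpoint-free j (position j)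
    where
    involutive : ∀ j → Position j → rewire τ p q ! (rewire τ p q ! j) ≡ j
    involutive j (at-p refl)  rewrite rewire-p  = rewire-q
    involutive j (at-τp refl) rewrite rewire-τp = rewire-τq
    involutive j (at-q refl)  rewrite rewire-q  = rewire-p
    involutive j (at-τq refl) rewrite rewire-τq = rewire-τp
    involutive j (elsewhere j≢p j≢τp j≢q j≢τq) with elsewhere-partner perf j≢p j≢τp j≢q j≢τq
    ... | τj≢p , τj≢τp , τj≢q , τj≢τq
      rewrite rewire-other j≢p j≢τp j≢q j≢τq | rewire-other τj≢p τj≢τp τj≢q τj≢τq = !-involutive perf j
    fixpoint-free : ∀ j → Position j → rewire τ p q ! j ≢ j
    fixpoint-free j (at-p refl)  rewrite rewire-p  = b≢a
    fixpoint-free j (at-τp refl) rewrite rewire-τp = b'≢a'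
    fixpoint-free j (at-q refl)  rewrite rewire-q  = ≢-sym b≢a
    fixpoint-free j (at-τq refl) rewrite rewire-τq = ≢-sym b'≢a'
    fixpoint-free j (elsewhere j≢p j≢τp j≢q j≢τq) rewrite rewire-other j≢p j≢τp j≢q j≢τq = !-≢ perf j

  rewire-unique : ∀ {ρ : Mat m} → Perfect ρ → ρ ! p ≡ q → ρ ! (τ ! p) ≡ τ ! q →
    (∀ {j} → j ≢ p → j ≢ τ ! p → j ≢ q → j ≢ τ ! q → ρ ! j ≡ τ ! j) → rewire τ p q ≡ ρ
  rewire-unique {ρ} perfρ ρp≡q ρτp≡τq ρ-elsewhere = Mat-ext λ j → agree j (position j)
    where
    agree : ∀ j → Position j → rewire τ p q ! j ≡ ρ ! j
    agree j (at-p refl)  = trans rewire-p (sym ρp≡q)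
    agree j (at-τp refl) = trans rewire-τp (sym ρτp≡τq)
    agree j (at-q refl)  = trans rewire-q (sym (!-flip perfρ ρp≡q))
    agree j (at-τq refl) = trans rewire-τq (sym (!-flip perfρ ρτp≡τq))
    agree j (elsewhere j≢p j≢τp j≢q j≢τq) = trans (rewire-other j≢p j≢τp j≢q j≢τq) (sym (ρ-elsewhere j≢p j≢τp j≢q j≢τq))

rewire-comm : ∀ {m} {τ : Mat m} {p q} → Perfect τ → Distinct₄ p (τ ! p) q (τ ! q) → rewire τ p q ≡ rewire τ q p
rewire-comm {τ = τ} perf d = sym (Rewire.rewire-unique {τ = τ} (Distinct₄-sym d) (rewire-perfect perf) rewire-q rewire-τq
                                λ j≢q j≢τq j≢p j≢τp → rewire-other j≢p j≢τp j≢q j≢τq)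
  where open Rewire {τ = τ} d

act-rewire : ∀ {m} {τ : Mat m} (i : Fin m) → Perfect τ → ∀ {a b} → Distinct₄ a (τ ! a) b (τ ! b) →
  act i (rewire τ a b) ≡ rewire (act i τ) (swapAt i a) (swapAt i b)
act-rewire {τ = τ} i perf {a} {b} d =
  sym (Rewire.rewire-unique {τ = act i τ} (Distinct₄-act {τ = τ} i d) (act-perfect i (R.rewire-perfect perf)) at-a at-τa elsewhere)
  where
  module R = Rewire {τ = τ} d
  s : _ → _
  s = swapAt i
  at-a : act i (rewire τ a b) ! s a ≡ s b
  at-a = trans (act-!-swapAt i (rewire τ a b) a) (cong s R.rewire-p)
  at-τa : act i (rewire τ a b) ! (act i τ ! s a) ≡ act i τ ! s b
  at-τa = trans (cong (act i (rewire τ a b) !_) (act-!-swapAt i τ a))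
                (trans (act-!-swapAt i (rewire τ a b) (τ ! a)) (trans (cong s R.rewire-τp) (sym (act-!-swapAt i τ b))))
  unswap : ∀ {j x y} → j ≢ y → y ≡ s x → s j ≢ x
  unswap {j} j≢y y≡sx sj≡x = j≢y (trans (sym (swapAt-involutive i j)) (trans (cong s sj≡x) (sym y≡sx)))
  elsewhere : ∀ {j} → j ≢ s a → j ≢ act i τ ! s a → j ≢ s b → j ≢ act i τ ! s b → act i (rewire τ a b) ! j ≡ act i τ ! j
  elsewhere {j} j≢sa j≢sτa j≢sb j≢sτb =
    trans (act-! i (rewire τ a b) j)
          (trans (cong s (R.rewire-other (unswap j≢sa refl) (unswap j≢sτa (act-!-swapAt i τ a))
                                         (unswap j≢sb refl) (unswap j≢sτb (act-!-swapAt i τ b))))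
                 (sym (act-! i τ j)))

module Resolve {m} {τ : Mat m} (perf : Perfect τ) {p q : Fin m} (d : Distinct₄ p (τ ! p) q (τ ! q))
               (p⋈q : crossing τ p q ≡ true) where
  open Distinct₄ d
  open Rewire {τ = τ} d

  τ' : Mat m
  τ' = rewire τ p q

  ends : (Fin m → ℕ) → ℕ
  ends f = f p + (f (τ ! p) + (f q + f (τ ! q)))

  away : (Fin m → ℕ) → Fin m → ℕ
  away f = (((f ∖ p) ∖ (τ ! p)) ∖ q) ∖ (τ ! q)

  ∑-ends-away : ∀ f → ∑ f ≡ ends f + ∑ (away f)
  ∑-ends-away f = begin
    ∑ f                                                   ≡⟨ ∑-∖ f p ⟩
    f p + ∑ f₁                                            ≡⟨ cong (f p +_) (∑-∖ f₁ (τ ! p)) ⟩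
    f p + (f₁ (τ ! p) + ∑ f₂)                             ≡⟨ cong (λ x → f p + (x + ∑ f₂)) (∖-≢ f (≢-sym a≢a')) ⟩
    f p + (f (τ ! p) + ∑ f₂)                              ≡⟨ cong (λ x → f p + (f (τ ! p) + x)) (∑-∖ f₂ q) ⟩
    f p + (f (τ ! p) + (f₂ q + ∑ f₃))                     ≡⟨ cong (λ x → f p + (f (τ ! p) + (x + ∑ f₃))) f₂q ⟩
    f p + (f (τ ! p) + (f q + ∑ f₃))                      ≡⟨ cong (λ x → f p + (f (τ ! p) + (f q + x))) (∑-∖ f₃ (τ ! q)) ⟩
    f p + (f (τ ! p) + (f q + (f₃ (τ ! q) + ∑ (away f)))) ≡⟨ cong (λ x → f p + (f (τ ! p) + (f q + (x + ∑ (away f))))) f₃τq ⟩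
    f p + (f (τ ! p) + (f q + (f (τ ! q) + ∑ (away f)))) ≡⟨ solve 5 (λ x₁ x₂ x₃ x₄ x₅ → x₁ :+ (x₂ :+ (x₃ :+ (x₄ :+ x₅))) := (x₁ :+ (x₂ :+ (x₃ :+ x₄))) :+ x₅)
                                                               refl (f p) (f (τ ! p)) (f q) (f (τ ! q)) (∑ (away f)) ⟩
    ends f + ∑ (away f)                                   ∎
    where
    open ≡-Reasoning
    open +-*-Solver
    f₁ f₂ f₃ : Fin m → ℕ
    f₁ = f ∖ p
    f₂ = f₁ ∖ (τ ! p)
    f₃ = f₂ ∖ q
    f₂q : f₂ q ≡ f q
    f₂q = trans (∖-≢ f₁ b≢a') (∖-≢ f b≢a)
    f₃τq : f₃ (τ ! q) ≡ f (τ ! q)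
    f₃τq = trans (∖-≢ f₂ (≢-sym b≢b')) (trans (∖-≢ f₁ b'≢a') (∖-≢ f b'≢a))

  away-≤ : ∀ {f g : Fin m → ℕ} → (∀ {a} → a ≢ p → a ≢ τ ! p → a ≢ q → a ≢ τ ! q → f a ≤ g a) → ∑ (away f) ≤ ∑ (away g)
  away-≤ {f} {g} f≤g = ∑-mono-≤ λ a →
    ∖-≤ {f = ((f ∖ p) ∖ (τ ! p)) ∖ q} {((g ∖ p) ∖ (τ ! p)) ∖ q} {τ ! q} {a} λ a≢τq →
    ∖-≤ {f = (f ∖ p) ∖ (τ ! p)} {(g ∖ p) ∖ (τ ! p)} {q} {a} λ a≢q →
    ∖-≤ {f = f ∖ p} {g ∖ p} {τ ! p} {a} λ a≢τp →
    ∖-≤ {f = f} {g} {p} {a} λ a≢p → f≤g a≢p a≢τp a≢q a≢τq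

  away-≡ : ∀ {f g : Fin m → ℕ} → (∀ {a} → a ≢ p → a ≢ τ ! p → a ≢ q → a ≢ τ ! q → f a ≡ g a) → ∑ (away f) ≡ ∑ (away g)
  away-≡ {f} {g} f≡g = sum-cong-≗ λ a →
    ∖-≡ {f = ((f ∖ p) ∖ (τ ! p)) ∖ q} {((g ∖ p) ∖ (τ ! p)) ∖ q} {τ ! q} {a} λ a≢τq →
    ∖-≡ {f = (f ∖ p) ∖ (τ ! p)} {(g ∖ p) ∖ (τ ! p)} {q} {a} λ a≢q →
    ∖-≡ {f = f ∖ p} {g ∖ p} {τ ! p} {a} λ a≢τp →
    ∖-≡ {f = f} {g} {p} {a} λ a≢p → f≡g a≢p a≢τp a≢q a≢τq

  ends-∑ : ∀ (g : Fin m → Fin m → ℕ) → ends (λ u → ∑ (g u)) ≡ ∑ (λ v → ends (λ u → g u v))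
  ends-∑ g = sym (begin
    ∑ (λ v → g p v + (g (τ ! p) v + (g q v + g (τ ! q) v)))
      ≡⟨ ∑-distrib-+ (g p) (λ v → g (τ ! p) v + (g q v + g (τ ! q) v)) ⟩
    ∑ (g p) + ∑ (λ v → g (τ ! p) v + (g q v + g (τ ! q) v))
      ≡⟨ cong (∑ (g p) +_) (∑-distrib-+ (g (τ ! p)) (λ v → g q v + g (τ ! q) v)) ⟩
    ∑ (g p) + (∑ (g (τ ! p)) + ∑ (λ v → g q v + g (τ ! q) v))
      ≡⟨ cong (λ x → ∑ (g p) + (∑ (g (τ ! p)) + x)) (∑-distrib-+ (g q) (g (τ ! q))) ⟩
    ends (λ u → ∑ (g u)) ∎)
    where open ≡-Reasoning

  ends-cong : ∀ {f g : Fin m → ℕ} → (∀ u → f u ≡ g u) → ends f ≡ ends g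
  ends-cong f≗g = cong₂ _+_ (f≗g p) (cong₂ _+_ (f≗g (τ ! p)) (cong₂ _+_ (f≗g q) (f≗g (τ ! q))))

  old new : Fin m → Fin m → ℕ
  old a b = 𝟙 (crossing τ a b)
  new a b = 𝟙 (crossing τ' a b)

  new≡old : ∀ {a b} → a ≢ p → a ≢ τ ! p → a ≢ q → a ≢ τ ! q → b ≢ p → b ≢ τ ! p → b ≢ q → b ≢ τ ! q → new a b ≡ old a b
  new≡old a≢p a≢τp a≢q a≢τq b≢p b≢τp b≢q b≢τq
    rewrite rewire-other a≢p a≢τp a≢q a≢τq | rewire-other b≢p b≢τp b≢q b≢τq = refl

  -- A chord away from the resolved pair meets the new pair at most as often as the old one:
  -- it could only gain crossings if the old chords lay on opposite sides of it, but they cross.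
  ends-new≤old : ∀ {a} → a ≢ p → a ≢ τ ! p → a ≢ q → a ≢ τ ! q → ends (new a) ≤ ends (old a)
  ends-new≤old {a} a≢p a≢τp a≢q a≢τq
    rewrite rewire-other a≢p a≢τp a≢q a≢τq | rewire-p | rewire-τp | rewire-q | rewire-τq | !-involutive perf p | !-involutive perf q
    = resolve-≤ (side p) (side (τ ! p)) (side q) (side (τ ! q)) impossible
    where
    lo hi : ℕ
    lo = toℕ a ⊓ toℕ (τ ! a)
    hi = toℕ a ⊔ toℕ (τ ! a)
    side : Fin m → Bool
    side z = between lo (toℕ z) hi
    impossible : ¬ (side p ≡ side (τ ! p) × side q ≡ side (τ ! q) × side p ≡ not (side q))
    impossible (sp≡sτp , sq≡sτq , sp≡¬sq) with side p in sp | side q in sq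
    ... | true  | true  = true≢false sp≡¬sq
    ... | false | false = true≢false (sym sp≡¬sq)
    ... | true  | false = true≢false (trans (sym p⋈q) (cong₂ _xor_
          (between-outside {lo} {hi} (toℕ p) (toℕ (τ ! p)) (toℕ q) sp (sym sp≡sτp) sq)
          (between-outside {lo} {hi} (toℕ p) (toℕ (τ ! p)) (toℕ (τ ! q)) sp (sym sp≡sτp) (sym sq≡sτq))))
    ... | false | true  = true≢false (trans (sym p⋈q) (trans (crosses-sym d) (cong₂ _xor_
          (between-outside {lo} {hi} (toℕ q) (toℕ (τ ! q)) (toℕ p) sq (sym sq≡sτq) sp)
          (between-outside {lo} {hi} (toℕ q) (toℕ (τ ! q)) (toℕ (τ ! p)) sq (sym sq≡sτq) (sym sp≡sτp)))))

  columns-new≤8 : ends (λ v → ends (λ u → new u v)) ≤ 8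
  columns-new≤8 = +-mono-≤ column-p (+-mono-≤ column-τp (+-mono-≤ column-q column-τq))
    where
    pair≤2 : ∀ x y → 𝟙 x + 𝟙 y ≤ 2
    pair≤2 x y = +-mono-≤ (𝟙≤1 x) (𝟙≤1 y)
    pair≤2ʳ : ∀ x y → 𝟙 x + (𝟙 y + 0) ≤ 2
    pair≤2ʳ x y = subst (_≤ 2) (cong (𝟙 x +_) (sym (+-identityʳ (𝟙 y)))) (pair≤2 x y)
    column-p : ends (λ u → new u p) ≤ 2
    column-p rewrite rewire-p | rewire-q | rewire-τp | rewire-τq | crosses-self p q | crosses-self-reversed q p =
      pair≤2 (crosses (τ ! p) (τ ! q) p q) (crosses (τ ! q) (τ ! p) p q)
    column-τp : ends (λ u → new u (τ ! p)) ≤ 2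
    column-τp rewrite rewire-p | rewire-q | rewire-τp | rewire-τq | crosses-self (τ ! p) (τ ! q) | crosses-self-reversed (τ ! q) (τ ! p) =
      pair≤2ʳ (crosses p q (τ ! p) (τ ! q)) (crosses q p (τ ! p) (τ ! q))
    column-q : ends (λ u → new u q) ≤ 2
    column-q rewrite rewire-p | rewire-q | rewire-τp | rewire-τq | crosses-self-reversed p q | crosses-self q p =
      pair≤2 (crosses (τ ! p) (τ ! q) q p) (crosses (τ ! q) (τ ! p) q p)
    column-τq : ends (λ u → new u (τ ! q)) ≤ 2
    column-τq rewrite rewire-p | rewire-q | rewire-τp | rewire-τq | crosses-self-reversed (τ ! p) (τ ! q) | crosses-self (τ ! q) (τ ! p) =
      pair≤2ʳ (crosses p q (τ ! q) (τ ! p)) (crosses q p (τ ! q) (τ ! p))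

  p'⋈q : crosses (τ ! p) p q (τ ! q) ≡ true
  p'⋈q = trans (sym (crosses-flipˡ p (τ ! p) q (τ ! q))) p⋈q
  p⋈q' : crosses p (τ ! p) (τ ! q) q ≡ true
  p⋈q' = trans (sym (crosses-flipʳ p (τ ! p) q (τ ! q))) p⋈q
  p'⋈q' : crosses (τ ! p) p (τ ! q) q ≡ true
  p'⋈q' = trans (sym (crosses-flipˡ p (τ ! p) (τ ! q) q)) p⋈q'
  q⋈p : crosses q (τ ! q) p (τ ! p) ≡ true
  q⋈p = trans (sym (crosses-sym d)) p⋈q
  q'⋈p : crosses (τ ! q) q p (τ ! p) ≡ true
  q'⋈p = trans (sym (crosses-flipˡ q (τ ! q) p (τ ! p))) q⋈p
  q⋈p' : crosses q (τ ! q) (τ ! p) p ≡ true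
  q⋈p' = trans (sym (crosses-flipʳ q (τ ! q) p (τ ! p))) q⋈p
  q'⋈p' : crosses (τ ! q) q (τ ! p) p ≡ true
  q'⋈p' = trans (sym (crosses-flipˡ q (τ ! q) (τ ! p) p)) q⋈p'

  columns-old≡8 : ends (λ v → ends (λ u → old u v)) ≡ 8
  columns-old≡8
    rewrite !-involutive perf p | !-involutive perf q
          | crosses-self p (τ ! p) | crosses-self-reversed (τ ! p) p | crosses-self q (τ ! q) | crosses-self-reversed (τ ! q) q
          | crosses-self-reversed p (τ ! p) | crosses-self (τ ! p) p | crosses-self-reversed q (τ ! q) | crosses-self (τ ! q) q
          | p⋈q | p'⋈q | p⋈q' | p'⋈q' | q⋈p | q'⋈p | q⋈p' | q'⋈p' = refl

  crossings-rewire-≤ : crossings τ' ≤ crossings τ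
  crossings-rewire-≤ = begin
    crossings τ'                                          ≡⟨ ∑-ends-away (λ a → ∑ (new a)) ⟩
    ends (λ a → ∑ (new a)) + ∑ (away (λ a → ∑ (new a)))  ≤⟨ +-mono-≤ ends-part away-part ⟩
    ends (λ a → ∑ (old a)) + ∑ (away (λ a → ∑ (old a)))  ≡⟨ sym (∑-ends-away (λ a → ∑ (old a))) ⟩
    crossings τ                                           ∎
    where
    open ≤-Reasoning
    column-new≤old : ∀ {v} → v ≢ p → v ≢ τ ! p → v ≢ q → v ≢ τ ! q → ends (λ u → new u v) ≤ ends (λ u → old u v)
    column-new≤old {v} v≢p v≢τp v≢q v≢τq = begin
      ends (λ u → new u v)   ≡⟨ ends-cong (λ u → cong 𝟙 (crossing-sym (rewire-perfect perf) u v)) ⟩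
      ends (new v)           ≤⟨ ends-new≤old v≢p v≢τp v≢q v≢τq ⟩
      ends (old v)           ≡⟨ ends-cong (λ u → cong 𝟙 (crossing-sym perf v u)) ⟩
      ends (λ u → old u v)   ∎
    ends-part : ends (λ a → ∑ (new a)) ≤ ends (λ a → ∑ (old a))
    ends-part = begin
      ends (λ a → ∑ (new a))
        ≡⟨ ends-∑ new ⟩
      ∑ (λ v → ends (λ u → new u v))
        ≡⟨ ∑-ends-away (λ v → ends (λ u → new u v)) ⟩
      ends (λ v → ends (λ u → new u v)) + ∑ (away (λ v → ends (λ u → new u v)))
        ≤⟨ +-mono-≤ columns-new≤8 (away-≤ column-new≤old) ⟩
      8 + ∑ (away (λ v → ends (λ u → old u v)))
        ≡⟨ cong (_+ ∑ (away (λ v → ends (λ u → old u v)))) (sym columns-old≡8) ⟩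
      ends (λ v → ends (λ u → old u v)) + ∑ (away (λ v → ends (λ u → old u v)))
        ≡⟨ sym (∑-ends-away (λ v → ends (λ u → old u v))) ⟩
      ∑ (λ v → ends (λ u → old u v))
        ≡⟨ sym (ends-∑ old) ⟩
      ends (λ a → ∑ (old a)) ∎
    away-part : ∑ (away (λ a → ∑ (new a))) ≤ ∑ (away (λ a → ∑ (old a)))
    away-part = away-≤ λ {a} a≢p a≢τp a≢q a≢τq → begin
      ∑ (new a)                        ≡⟨ ∑-ends-away (new a) ⟩
      ends (new a) + ∑ (away (new a))  ≤⟨ +-mono-≤ (ends-new≤old a≢p a≢τp a≢q a≢τq)
                                                   (≤-reflexive (away-≡ (new≡old a≢p a≢τp a≢q a≢τq))) ⟩
      ends (old a) + ∑ (away (old a))  ≡⟨ sym (∑-ends-away (old a)) ⟩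
      ∑ (old a)                        ∎

-- The strands at i and i + 1

module TwoStrands {k} {τ : Mat (suc k)} (perf : Perfect τ) (i : Fin (suc k)) (τi≢n : τ ! i ≢ next i) where

  n : Fin (suc k)
  n = next i

  i≢n : i ≢ n
  i≢n = next-≢ perf i

  τn≢i : τ ! n ≢ i
  τn≢i τn≡i = τi≢n (!-flip perf τn≡i)

  distinct : Distinct₄ i (τ ! i) n (τ ! n)
  distinct = distinct₄ (≢-sym (!-≢ perf i)) (≢-sym (!-≢ perf n)) (≢-sym i≢n) (≢-sym τi≢n) τn≢i
                       (λ τn≡τi → i≢n (!-injective perf (sym τn≡τi)))

  act-i : act i τ ! i ≡ τ ! n
  act-i = trans (act-! i τ i) (trans (cong (λ x → swapAt i (τ ! x)) (swapAt-i i)) (swapAt-other i (τ ! n) τn≢i (!-≢ perf n)))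

  act-n : act i τ ! n ≡ τ ! i
  act-n = trans (act-! i τ n) (trans (cong (λ x → swapAt i (τ ! x)) (swapAt-next i i≢n)) (swapAt-other i (τ ! i) (!-≢ perf i) τi≢n))

  act-τi : act i τ ! (τ ! i) ≡ n
  act-τi = trans (act-! i τ (τ ! i)) (trans (cong (λ x → swapAt i (τ ! x)) (swapAt-other i (τ ! i) (!-≢ perf i) τi≢n))
                                           (trans (cong (swapAt i) (!-involutive perf i)) (swapAt-i i)))

  act-i≢n : act i τ ! i ≢ n
  act-i≢n act-i≡n = !-≢ perf n (trans (sym act-i) act-i≡n)

  crossing-act-i-n : crossing (act i τ) i n ≡ not (crossing τ i n)
  crossing-act-i-n = begin
    crossing (act i τ) i n                                   ≡⟨ crossing-sym (act-perfect i perf) i n ⟩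
    crossing (act i τ) n i                                   ≡⟨ cong₂ (crossing (act i τ)) (sym (swapAt-i i)) (sym (swapAt-next i i≢n)) ⟩
    crossing (act i τ) (swapAt i i) (swapAt i n)             ≡⟨ crossing-act perf i distinct ⟩
    crossing τ i n xor splits i n i (τ ! i) n (τ ! n)        ≡⟨ cong (crossing τ i n xor_) splits-i-n ⟩
    crossing τ i n xor true                                  ≡⟨ xor-trueʳ (crossing τ i n) ⟩
    not (crossing τ i n)                                     ∎
    where
    open ≡-Reasoning
    splits-i-n : splits i n i (τ ! i) n (τ ! n) ≡ true
    splits-i-n rewrite ==-refl i | ==-refl n | ==-false i≢n | ==-false τi≢n = refl

  on-i : Fin (suc k) → Bool
  on-i a = hasEnd a (τ ! a) i

  on-n : Fin (suc k) → Bool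
  on-n a = hasEnd a (τ ! a) n

  on-i-partner : ∀ a → on-i (τ ! a) ≡ on-i a
  on-i-partner a rewrite !-involutive perf a = ∨-comm (τ ! a == i) (a == i)

  on-n-partner : ∀ a → on-n (τ ! a) ≡ on-n a
  on-n-partner a rewrite !-involutive perf a = ∨-comm (τ ! a == n) (a == n)

  on-i∧on-n : ∀ a → on-i a ∧ on-n a ≡ false
  on-i∧on-n a with a ≟ i | τ ! a ≟ i | a ≟ n | τ ! a ≟ n
  ... | yes refl | _        | yes i≡n  | _        = ⊥-elim (i≢n i≡n)
  ... | _        | yes τa≡i | _        | yes τa≡n = ⊥-elim (i≢n (trans (sym τa≡i) τa≡n))
  ... | yes refl | _        | no _     | yes τi≡n = ⊥-elim (τi≢n τi≡n)
  ... | no _     | yes τa≡i | yes refl | _        = ⊥-elim (τn≢i τa≡i)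
  ... | no _     | no _     | _        | _        = refl
  ... | yes refl | no _     | no _     | no _     = refl
  ... | yes refl | yes _    | no _     | no _     = refl
  ... | no _     | yes _    | no _     | no _     = refl

  crossing-on-i-on-n : ∀ a b → on-i a ≡ true → on-n b ≡ true → crossing τ a b ≡ crossing τ i n
  crossing-on-i-on-n a b a-on-i b-on-n = trans (to-i (hasEnd-true⇒ a-on-i)) (to-n (hasEnd-true⇒ b-on-n))
    where
    to-i : a ≡ i ⊎ τ ! a ≡ i → crossing τ a b ≡ crossing τ i b
    to-i (inj₁ refl) = refl
    to-i (inj₂ τa≡i) = trans (cong (λ x → crossing τ x b) (sym (!-flip perf τa≡i))) (crossing-partnerˡ perf i b)
    to-n : b ≡ n ⊎ τ ! b ≡ n → crossing τ i b ≡ crossing τ i n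
    to-n (inj₁ refl) = refl
    to-n (inj₂ τb≡n) = trans (cong (crossing τ i) (sym (!-flip perf τb≡n))) (crossing-partnerʳ perf i n)

  ∑-on-i : ∑ (λ a → 𝟙 (on-i a)) ≡ 2
  ∑-on-i = trans (sum-cong-≗ λ a → cong (λ c → 𝟙 ((a == i) ∨ c)) (!-== perf a i)) (∑-𝟙-pair i (τ ! i) (≢-sym (!-≢ perf i)))

  ∑-on-n : ∑ (λ a → 𝟙 (on-n a)) ≡ 2
  ∑-on-n = trans (sum-cong-≗ λ a → cong (λ c → 𝟙 ((a == n) ∨ c)) (!-== perf a n)) (∑-𝟙-pair n (τ ! n) (≢-sym (!-≢ perf n)))

  gained : Fin (suc k) → Fin (suc k) → ℕ
  gained a b = 𝟙 (on-i a ∧ on-n b) + 𝟙 (on-n a ∧ on-i b)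

  ∑-gained : ∑ (λ a → ∑ (gained a)) ≡ 8
  ∑-gained = begin
    ∑ (λ a → ∑ (gained a))
      ≡⟨ sum-cong-≗ (λ a → ∑-distrib-+ (λ b → 𝟙 (on-i a ∧ on-n b)) (λ b → 𝟙 (on-n a ∧ on-i b))) ⟩
    ∑ (λ a → ∑ (λ b → 𝟙 (on-i a ∧ on-n b)) + ∑ (λ b → 𝟙 (on-n a ∧ on-i b)))
      ≡⟨ ∑-distrib-+ (λ a → ∑ (λ b → 𝟙 (on-i a ∧ on-n b))) (λ a → ∑ (λ b → 𝟙 (on-n a ∧ on-i b))) ⟩
    ∑ (λ a → ∑ (λ b → 𝟙 (on-i a ∧ on-n b))) + ∑ (λ a → ∑ (λ b → 𝟙 (on-n a ∧ on-i b)))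
      ≡⟨ cong₂ _+_ (trans (∑-𝟙-∧ on-i on-n) (cong₂ _*_ ∑-on-i ∑-on-n)) (trans (∑-𝟙-∧ on-n on-i) (cong₂ _*_ ∑-on-n ∑-on-i)) ⟩
    8 ∎
    where open ≡-Reasoning

  gained-self : ∀ a → gained a a ≡ 0
  gained-self a rewrite on-i∧on-n a | ∧-comm (on-n a) (on-i a) | on-i∧on-n a = refl

  module _ (uncrossed : crossing τ i n ≡ false) where

    𝟙-crossing-act : ∀ a b → 𝟙 (crossing (act i τ) (swapAt i a) (swapAt i b)) ≡ 𝟙 (crossing τ a b) + gained a b
    𝟙-crossing-act a b with relative perf a b
    ... | same refl rewrite crossing-self (act i τ) (swapAt i a) | crossing-self τ a | gained-self a = refl
    ... | partner refl = begin
      𝟙 (crossing (act i τ) (swapAt i a) (swapAt i (τ ! a)))   ≡⟨ cong (λ x → 𝟙 (crossing (act i τ) (swapAt i a) x)) (sym (act-!-swapAt i τ a)) ⟩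
      𝟙 (crossing (act i τ) (swapAt i a) (act i τ ! swapAt i a)) ≡⟨ cong 𝟙 (crossing-partner (act-perfect i perf) (swapAt i a)) ⟩
      0                                                          ≡⟨ cong₂ _+_ (cong 𝟙 (sym (crossing-partner perf a))) (sym gained-partner) ⟩
      𝟙 (crossing τ a (τ ! a)) + gained a (τ ! a)               ∎
      where
      open ≡-Reasoning
      gained-partner : gained a (τ ! a) ≡ 0
      gained-partner rewrite on-i-partner a | on-n-partner a = gained-self a
    ... | apart d = trans (cong 𝟙 (crossing-act perf i d))
                          (𝟙-xor₃ (crossing τ a b) (on-i a ∧ on-n b) (on-n a ∧ on-i b) (i-n a b) n-i (i-n-exclusive a b))
      where
      i-n : ∀ a b → on-i a ∧ on-n b ≡ true → crossing τ a b ≡ false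
      i-n a b h = trans (crossing-on-i-on-n a b (proj₁ (∧-true⇒ h)) (proj₂ (∧-true⇒ h))) uncrossed
      n-i : on-n a ∧ on-i b ≡ true → crossing τ a b ≡ false
      n-i h = trans (crossing-sym perf a b) (i-n b a (trans (∧-comm (on-i b) (on-n a)) h))
      i-n-exclusive : ∀ a b → (on-i a ∧ on-n b) ∧ (on-n a ∧ on-i b) ≡ false
      i-n-exclusive a b with on-i a in x | on-n a in y
      ... | true  | true  = ⊥-elim (true≢false (trans (sym (cong₂ _∧_ x y)) (on-i∧on-n a)))
      ... | false | _     = refl
      ... | true  | false = ∧-comm (on-n b) false

    crossings-act : crossings (act i τ) ≡ crossings τ + 8
    crossings-act = begin
      crossings (act i τ)
        ≡⟨ sym (∑-involution (swapAt i) (swapAt-involutive i) (λ a → ∑ (λ b → 𝟙 (crossing (act i τ) a b)))) ⟩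
      ∑ (λ a → ∑ (λ b → 𝟙 (crossing (act i τ) (swapAt i a) b)))
        ≡⟨ sum-cong-≗ (λ a → sym (∑-involution (swapAt i) (swapAt-involutive i) (λ b → 𝟙 (crossing (act i τ) (swapAt i a) b)))) ⟩
      ∑ (λ a → ∑ (λ b → 𝟙 (crossing (act i τ) (swapAt i a) (swapAt i b))))
        ≡⟨ sum-cong-≗ (λ a → trans (sum-cong-≗ (𝟙-crossing-act a)) (∑-distrib-+ (λ b → 𝟙 (crossing τ a b)) (gained a))) ⟩
      ∑ (λ a → ∑ (λ b → 𝟙 (crossing τ a b)) + ∑ (gained a))
        ≡⟨ ∑-distrib-+ (λ a → ∑ (λ b → 𝟙 (crossing τ a b))) (λ a → ∑ (gained a)) ⟩
      crossings τ + ∑ (λ a → ∑ (gained a))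
        ≡⟨ cong (crossings τ +_) ∑-gained ⟩
      crossings τ + 8 ∎
      where open ≡-Reasoning

  act-elsewhere : ∀ {j} → j ≢ i → j ≢ τ ! i → j ≢ n → j ≢ τ ! n → act i τ ! j ≡ τ ! j
  act-elsewhere {j} j≢i j≢τi j≢n j≢τn =
    trans (act-! i τ j) (trans (cong (λ x → swapAt i (τ ! x)) (swapAt-other i j j≢i j≢n))
                               (swapAt-other i (τ ! j) (λ τj≡i → j≢τi (sym (!-flip perf τj≡i))) (λ τj≡n → j≢τn (sym (!-flip perf τj≡n)))))

  rewire-i-τn : Distinct₄ i (τ ! i) (τ ! n) (τ ! (τ ! n)) → rewire τ i (τ ! n) ≡ act i τ
  rewire-i-τn d = Rewire.rewire-unique {τ = τ} d (act-perfect i perf) act-i (trans act-τi (sym (!-involutive perf n)))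
    λ j≢i j≢τi j≢τn j≢ττn → act-elsewhere j≢i j≢τi (λ j≡n → j≢ττn (trans j≡n (sym (!-involutive perf n)))) j≢τn

  rewire-τi-n : Distinct₄ (τ ! i) (τ ! (τ ! i)) n (τ ! n) → rewire τ (τ ! i) n ≡ act i τ
  rewire-τi-n d = Rewire.rewire-unique {τ = τ} d (act-perfect i perf) act-τi (trans (cong (act i τ !_) (!-involutive perf i)) act-i)
    λ j≢τi j≢ττi j≢n j≢τn → act-elsewhere (λ j≡i → j≢ττi (trans j≡i (sym (!-involutive perf i)))) j≢τi j≢n j≢τn

  rewire-on-i-on-n : ∀ {a b} → Distinct₄ a (τ ! a) b (τ ! b) → on-i a ≡ true → on-n b ≡ true →
    rewire τ a b ! i ≡ n ⊎ rewire τ a b ≡ act i τ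
  rewire-on-i-on-n {a} {b} d a-on-i b-on-n with hasEnd-true⇒ {a = a} {τ ! a} {i} a-on-i | hasEnd-true⇒ {a = b} {τ ! b} {n} b-on-n
  ... | inj₁ refl | inj₁ refl = inj₁ (Rewire.rewire-p {τ = τ} d)
  ... | inj₁ refl | inj₂ τb≡n rewrite sym (!-flip perf τb≡n) = inj₂ (rewire-i-τn d)
  ... | inj₂ τa≡i | inj₁ refl rewrite sym (!-flip perf τa≡i) = inj₂ (rewire-τi-n d)
  ... | inj₂ τa≡i | inj₂ τb≡n = inj₁ (subst₂ (λ x y → rewire τ a b ! x ≡ y) τa≡i τb≡n (Rewire.rewire-τp {τ = τ} d))

  rewire-splits : ∀ {a b} → Distinct₄ a (τ ! a) b (τ ! b) → splits i n a (τ ! a) b (τ ! b) ≡ true →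
    rewire τ a b ! i ≡ n ⊎ rewire τ a b ≡ act i τ
  rewire-splits {a} {b} d split with xor-true⇒ split
  ... | inj₁ on-i-n = rewire-on-i-on-n d (proj₁ (∧-true⇒ on-i-n)) (proj₂ (∧-true⇒ on-i-n))
  ... | inj₂ on-n-i rewrite rewire-comm perf d = rewire-on-i-on-n (Distinct₄-sym d) (proj₂ (∧-true⇒ on-n-i)) (proj₁ (∧-true⇒ on-n-i))

  act-covers : crossing τ i n ≡ false → τ ⋖ act i τ
  act-covers uncrossed = i , τ ! i , i⋈τi , sym τ-as-rewire , crossingNumber-suc perf (act-perfect i perf) (sym (crossings-act uncrossed))
    where
    i⋈τi : crosses i (act i τ ! i) (τ ! i) (act i τ ! (τ ! i)) ≡ true
    i⋈τi = begin
      crosses i (act i τ ! i) (τ ! i) (act i τ ! (τ ! i))  ≡⟨ cong₂ (λ x y → crosses i x (τ ! i) y) act-i act-τi ⟩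
      crosses i (τ ! n) (τ ! i) n                          ≡⟨ sym (crosses-flipʳ i (τ ! n) n (τ ! i)) ⟩
      crosses i (τ ! n) n (τ ! i)                          ≡⟨ sym (cong₂ (λ x y → crosses i x n y) act-i act-n) ⟩
      crossing (act i τ) i n                               ≡⟨ crossing-act-i-n ⟩
      not (crossing τ i n)                                 ≡⟨ cong not uncrossed ⟩
      true                                                 ∎
      where open ≡-Reasoning
    d : Distinct₄ i (act i τ ! i) (τ ! i) (act i τ ! (τ ! i))
    d = subst₂ (λ x y → Distinct₄ i x (τ ! i) y) (sym act-i) (sym act-τi)
          (distinct₄ (≢-sym τn≢i) τi≢n (!-≢ perf i) (λ τi≡τn → i≢n (!-injective perf τi≡τn)) (≢-sym i≢n) (≢-sym (!-≢ perf n)))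
    τ-as-rewire : rewire (act i τ) i (τ ! i) ≡ τ
    τ-as-rewire = Rewire.rewire-unique {τ = act i τ} d perf refl (trans (cong (τ !_) act-i) (trans (!-involutive perf n) (sym act-τi)))
      λ {j} j≢i j≢τn j≢τi j≢n → sym (act-elsewhere j≢i j≢τi (λ j≡n → j≢n (trans j≡n (sym act-τi))) (λ j≡τn → j≢τn (trans j≡τn (sym act-i))))

InB⇒InA-act : ∀ {k} {τ : Mat (suc k)} {i} → Perfect τ → InB τ i → InA (act i τ) i
InB⇒InA-act {i = i} perf (τi≢n , crossed) = act-i≢n , trans crossing-act-i-n (cong not crossed)
  where open TwoStrands perf i τi≢n

crossings-act-B : ∀ {k} {τ : Mat (suc k)} {i} → Perfect τ → InB τ i → crossings (act i τ) + 8 ≡ crossings τ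
crossings-act-B {τ = τ} {i} perf B with InB⇒InA-act perf B
... | sτi≢n , uncrossed = trans (sym (TwoStrands.crossings-act (act-perfect i perf) i sτi≢n uncrossed)) (cong crossings (act-involutive i τ))

act-covered : ∀ {k} {τ : Mat (suc k)} {i} → Perfect τ → InB τ i → act i τ ⋖ τ
act-covered {τ = τ} {i} perf B with InB⇒InA-act perf B
... | sτi≢n , uncrossed = subst (act i τ ⋖_) (act-involutive i τ) (TwoStrands.act-covers (act-perfect i perf) i sτi≢n uncrossed)

module Adjacent {k} {τ : Mat (suc k)} (perf : Perfect τ) {i : Fin (suc k)} (τi≡n : τ ! i ≡ next i) where

  adjacent-uncrossed : ∀ {a b} → Distinct₄ a (τ ! a) b (τ ! b) → hasEnd a (τ ! a) i ≡ true → crossing τ a b ≡ false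
  adjacent-uncrossed {a} {b} (distinct₄ _ _ b≢a b≢τa τb≢a τb≢τa) a∈ with hasEnd-true⇒ {a = a} {τ ! a} {i} a∈
  ... | inj₁ refl = trans (cong (λ x → crosses a x b (τ ! b)) τi≡n)
                          (crosses-adjacent a (next-≢ perf a) b≢a (λ b≡n → b≢τa (trans b≡n (sym τi≡n)))
                                                           τb≢a (λ τb≡n → τb≢τa (trans τb≡n (sym τi≡n))))
  ... | inj₂ τa≡i = trans (cong₂ (λ x y → crosses x y b (τ ! b)) a≡n τa≡i)
                          (trans (sym (crosses-flipˡ i (next i) b (τ ! b)))
                                 (crosses-adjacent i (next-≢ perf i) (λ b≡i → b≢τa (trans b≡i (sym τa≡i))) (λ b≡n → b≢a (trans b≡n (sym a≡n)))
                                                                  (λ τb≡i → τb≢τa (trans τb≡i (sym τa≡i))) (λ τb≡n → τb≢a (trans τb≡n (sym a≡n)))))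
    where
    a≡n : a ≡ next i
    a≡n = trans (sym (!-flip perf τa≡i)) τi≡n

  off-crossing : ∀ {a b} → Distinct₄ a (τ ! a) b (τ ! b) → crossing τ a b ≡ true → (i ≢ a) × (i ≢ τ ! a)
  off-crossing {a} {b} d a⋈b =
    (λ i≡a → true≢false (trans (sym a⋈b) (adjacent-uncrossed d (subst (λ x → hasEnd a (τ ! a) x ≡ true) (sym i≡a) (hasEnd-self a (τ ! a)))))) ,
    (λ i≡τa → true≢false (trans (sym a⋈b) (adjacent-uncrossed d (subst (λ x → hasEnd a (τ ! a) x ≡ true) (sym i≡τa) (hasEnd-partner a (τ ! a))))))

  rewire-keeps-adjacent : ∀ {a b} → Distinct₄ a (τ ! a) b (τ ! b) → crossing τ a b ≡ true → rewire τ a b ! i ≡ next i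
  rewire-keeps-adjacent {a} {b} d a⋈b with off-crossing d a⋈b | off-crossing (Distinct₄-sym d) (trans (crossing-sym perf b a) a⋈b)
  ... | i≢a , i≢τa | i≢b , i≢τb = trans (Rewire.rewire-other {τ = τ} d i≢a i≢τa i≢b i≢τb) τi≡n

-- Lifting covers along s_i

data Status {k} (τ : Mat (suc k)) (i : Fin (suc k)) : Set where
  inC : τ ! i ≡ next i → Status τ i
  inA : InA τ i → Status τ i
  inB : InB τ i → Status τ i

status : ∀ {k} (τ : Mat (suc k)) i → Status τ i
status τ i with τ ! i ≟ next i | crossing τ i (next i) in eq
... | yes τi≡n | _     = inC τi≡n
... | no τi≢n  | false = inA (τi≢n , eq)
... | no τi≢n  | true  = inB (τi≢n , eq)

-- The larger and the smaller of τ and s_i · τ.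
upper lower : ∀ {k} → Fin (suc k) → Mat (suc k) → Mat (suc k)
upper i τ = if τ ! i == next i then τ else (if crossing τ i (next i) then τ else act i τ)
lower i τ = if τ ! i == next i then τ else (if crossing τ i (next i) then act i τ else τ)

module _ {k} {i : Fin (suc k)} (τ : Mat (suc k)) where

  upper-C : τ ! i ≡ next i → upper i τ ≡ τ
  upper-C τi≡n rewrite τi≡n | ==-refl (next i) = refl

  upper-A : InA τ i → upper i τ ≡ act i τ
  upper-A (τi≢n , uncrossed) rewrite ==-false τi≢n | uncrossed = refl

  upper-B : InB τ i → upper i τ ≡ τ
  upper-B (τi≢n , crossed) rewrite ==-false τi≢n | crossed = refl

  lower-A : InA τ i → lower i τ ≡ τ
  lower-A (τi≢n , uncrossed) rewrite ==-false τi≢n | uncrossed = refl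

  lower-B : InB τ i → lower i τ ≡ act i τ
  lower-B (τi≢n , crossed) rewrite ==-false τi≢n | crossed = refl

≡⇒≤M : ∀ {m} {σ τ : Mat m} → σ ≡ τ → σ ≤M τ
≡⇒≤M refl = ε

module Cover {k} {τ : Mat (suc k)} (perf : Perfect τ) (i : Fin (suc k)) {a b : Fin (suc k)}
             (d : Distinct₄ a (τ ! a) b (τ ! b)) (a⋈b : crossing τ a b ≡ true)
             (count : crossings (rewire τ a b) + 8 ≡ crossings τ) where

  n : Fin (suc k)
  n = next i

  σ : Mat (suc k)
  σ = rewire τ a b

  σ-perfect : Perfect σ
  σ-perfect = Rewire.rewire-perfect {τ = τ} d perf

  σ⋖τ : σ ⋖ τ
  σ⋖τ = a , b , a⋈b , refl , crossingNumber-suc σ-perfect perf count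

  keeps-C : τ ! i ≡ n → σ ! i ≡ n
  keeps-C τi≡n = Adjacent.rewire-keeps-adjacent perf τi≡n d a⋈b

  split : Bool
  split = splits i n a (τ ! a) b (τ ! b)

  conjugate-crossing : split ≡ false → crossing (act i τ) (swapAt i a) (swapAt i b) ≡ true
  conjugate-crossing unsplit = trans (crossing-act perf i d) (cong₂ _xor_ a⋈b unsplit)

  conjugate-covers : split ≡ false → crossings (act i σ) + 8 ≡ crossings (act i τ) → act i σ ⋖ act i τ
  conjugate-covers unsplit count′ = swapAt i a , swapAt i b , conjugate-crossing unsplit , act-rewire i perf d ,
                                    crossingNumber-suc (act-perfect i σ-perfect) (act-perfect i perf) count′

  conjugate-≤ : split ≡ false → crossings (act i σ) ≤ crossings (act i τ)
  conjugate-≤ unsplit = subst (λ ρ → crossings ρ ≤ crossings (act i τ)) (sym (act-rewire i perf d))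
                              (Resolve.crossings-rewire-≤ (act-perfect i perf) (Distinct₄-act {τ = τ} i d) (conjugate-crossing unsplit))

  A-unsplit : InA τ i → split ≡ false
  A-unsplit (τi≢n , uncrossed) with split in eq
  ... | false = refl
  ... | true with xor-true⇒ eq
  ...   | inj₁ on-i-n = ⊥-elim (true≢false (trans (sym a⋈b)
                      (trans (TwoStrands.crossing-on-i-on-n perf i τi≢n a b (proj₁ (∧-true⇒ on-i-n)) (proj₂ (∧-true⇒ on-i-n))) uncrossed)))
  ...   | inj₂ on-n-i = ⊥-elim (true≢false (trans (sym a⋈b) (trans (crossing-sym perf a b)
                      (trans (TwoStrands.crossing-on-i-on-n perf i τi≢n b a (proj₂ (∧-true⇒ on-n-i)) (proj₁ (∧-true⇒ on-n-i))) uncrossed))))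

  -- Otherwise s_i · σ would be a resolution of s_i · τ with more crossings.
  B-unsplit-not-A : InB τ i → split ≡ false → ¬ InA σ i
  B-unsplit-not-A B unsplit (σi≢n , σ-uncrossed) = <⇒≱ act-τ<act-σ (conjugate-≤ unsplit)
    where
    act-τ<act-σ : crossings (act i τ) < crossings (act i σ)
    act-τ<act-σ = subst (crossings (act i τ) <_)
      (sym (trans (TwoStrands.crossings-act σ-perfect i σi≢n σ-uncrossed) (trans count (sym (crossings-act-B perf B)))))
      (m<m+n (crossings (act i τ)) (s≤s z≤n))

  B-split : InB τ i → split ≡ true → σ ! i ≡ n ⊎ σ ≡ act i τ
  B-split (τi≢n , _) = TwoStrands.rewire-splits perf i τi≢n d

  upper-mono : upper i σ ≤M upper i τ
  upper-mono with status τ i | status σ i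
  ... | inC τi≡n | _        = subst₂ _≤M_ (sym (upper-C σ (keeps-C τi≡n))) (sym (upper-C τ τi≡n)) (σ⋖τ ◅ ε)
  ... | inA A    | inC σi≡n = subst₂ _≤M_ (sym (upper-C σ σi≡n)) (sym (upper-A τ A)) (σ⋖τ ◅ TwoStrands.act-covers perf i (proj₁ A) (proj₂ A) ◅ ε)
  ... | inA A    | inB B′   = subst₂ _≤M_ (sym (upper-B σ B′)) (sym (upper-A τ A)) (σ⋖τ ◅ TwoStrands.act-covers perf i (proj₁ A) (proj₂ A) ◅ ε)
  ... | inA A    | inA A′   = subst₂ _≤M_ (sym (upper-A σ A′)) (sym (upper-A τ A)) (conjugate-covers (A-unsplit A) count′ ◅ ε)
    where
    count′ : crossings (act i σ) + 8 ≡ crossings (act i τ)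
    count′ = trans (cong (_+ 8) (TwoStrands.crossings-act σ-perfect i (proj₁ A′) (proj₂ A′)))
                   (trans (cong (_+ 8) count) (sym (TwoStrands.crossings-act perf i (proj₁ A) (proj₂ A))))
  ... | inB B    | inC σi≡n = subst₂ _≤M_ (sym (upper-C σ σi≡n)) (sym (upper-B τ B)) (σ⋖τ ◅ ε)
  ... | inB B    | inB B′   = subst₂ _≤M_ (sym (upper-B σ B′)) (sym (upper-B τ B)) (σ⋖τ ◅ ε)
  ... | inB B    | inA A′ with split in eq
  ...   | false = ⊥-elim (B-unsplit-not-A B eq A′)
  ...   | true with B-split B eq
  ...     | inj₁ σi≡n = ⊥-elim (proj₁ A′ σi≡n)
  ...     | inj₂ σ≡sτ = subst₂ _≤M_ (sym (upper-A σ A′)) (sym (upper-B τ B)) (≡⇒≤M (trans (cong (act i) σ≡sτ) (act-involutive i τ)))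

  lower-mono : σ ! i ≢ n → lower i σ ≤M lower i τ
  lower-mono σi≢n with status τ i | status σ i
  ... | _        | inC σi≡n = ⊥-elim (σi≢n σi≡n)
  ... | inC τi≡n | _        = ⊥-elim (σi≢n (keeps-C τi≡n))
  ... | inA A    | inA A′   = subst₂ _≤M_ (sym (lower-A σ A′)) (sym (lower-A τ A)) (σ⋖τ ◅ ε)
  ... | inA A    | inB B′   = subst₂ _≤M_ (sym (lower-B σ B′)) (sym (lower-A τ A)) (act-covered σ-perfect B′ ◅ σ⋖τ ◅ ε)
  ... | inB B    | inA A′ with split in eq
  ...   | false = ⊥-elim (B-unsplit-not-A B eq A′)
  ...   | true with B-split B eq
  ...     | inj₁ σi≡n = ⊥-elim (σi≢n σi≡n)
  ...     | inj₂ σ≡sτ = subst₂ _≤M_ (sym (lower-A σ A′)) (sym (lower-B τ B)) (≡⇒≤M σ≡sτ)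
  lower-mono σi≢n | inB B | inB B′ with split in eq
  ... | true with B-split B eq
  ...   | inj₁ σi≡n = ⊥-elim (σi≢n σi≡n)
  ...   | inj₂ σ≡sτ = ⊥-elim (true≢false (trans (sym (proj₂ B′)) (trans (cong (λ ρ → crossing ρ i n) σ≡sτ) (proj₂ (InB⇒InA-act perf B)))))
  lower-mono σi≢n | inB B | inB B′ | false = subst₂ _≤M_ (sym (lower-B σ B′)) (sym (lower-B τ B)) (conjugate-covers eq count′ ◅ ε)
    where
    count′ : crossings (act i σ) + 8 ≡ crossings (act i τ)
    count′ = +-cancelʳ-≡ 8 (crossings (act i σ) + 8) (crossings (act i τ))
               (trans (cong (_+ 8) (crossings-act-B σ-perfect B′)) (trans count (sym (crossings-act-B perf B))))

upper-lower-mono : ∀ {k} {σ τ : Mat (suc k)} (i : Fin (suc k)) → Perfect τ → σ ≤M τ →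
  Perfect σ × (upper i σ ≤M upper i τ) × (σ ! i ≢ next i → lower i σ ≤M lower i τ)
upper-lower-mono i perf ε = perf , ε , λ _ → ε
upper-lower-mono i perf (_◅_ {j = ρ} σ⋖ρ ρ≤τ) with upper-lower-mono i perf ρ≤τ | σ⋖ρ
... | perfρ , upper-≤ , lower-≤ | a , b , a⋈b , refl , count =
  C.σ-perfect , C.upper-mono ◅◅ upper-≤ , λ σi≢n → C.lower-mono σi≢n ◅◅ lower-≤ (λ ρi≡n → σi≢n (C.keeps-C ρi≡n))
  where
  d : Distinct₄ a (ρ ! a) b (ρ ! b)
  d = crossing⇒Distinct₄ perfρ a⋈b
  module C = Cover perfρ i d a⋈b (crossings-+8 (Rewire.rewire-perfect {τ = ρ} d perfρ) perfρ count)

lemma3p2 : (n : ℕ) (τ η : P n) (i : Fin (2 * n))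
    → proj₁ τ ≤M proj₁ η
    → InA (proj₁ τ) i → InB (proj₁ η) i
    → (proj₁ τ ≤M act i (proj₁ η)) × (act i (proj₁ τ) ≤M proj₁ η)
lemma3p2 zero _ _ ()
lemma3p2 (suc n) (τ , _) (η , η-perfect) i τ≤η A B with upper-lower-mono i (perfect η-perfect) τ≤η
... | _ , upper-≤ , lower-≤ =
  subst₂ _≤M_ (lower-A τ A) (lower-B η B) (lower-≤ (proj₁ A)) ,
  subst₂ _≤M_ (upper-A τ A) (upper-B η B) upper-≤
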